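{- For every integer $n \geq 6$, $s(n)$ equals the number of partitions of $n$ with parts $q_1 \geq q_2 \geq \cdots \geq q_h$ such that (a) $h \geq 4$; (b) any two consecutive parts are either equal or differ by one, i.e. $q_j - q_{j+1} \in \{0,1\}$ for all $1 \leq j \leq h-1$; (c) the two largest parts are equal, $q_1 = q_2$; (d) the three smallest parts are $q_{h-2} = 3$, $q_{h-1} = 2$, $q_h = 1$.
   Context: For $n \geq 0$ let $q(n)$ be the number of partitions of $n$ into distinct parts, with $q(0)=1$, and set $q(-1)=q(-2)=0$. Define $s(n) = q(n) - 2q(n-1) + q(n-2)$ for $n \geq 0$. -}

module Defs where

open import Data.Nat using (ℕ; zero; suc; _+_; _∸_; _≤ᵇ_; _≡ᵇ_; _<ᵇ_)
open import Data.Bool using (Bool; true; false; _∧_; _∨_)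
open import Data.List using (List; []; _∷_; length; map; concatMap; filterᵇ; reverse; upTo)
open import Data.Integer as ℤ using (ℤ; +_)

-- partitionsBounded fuel n m : all partitions of n (as weakly decreasing lists
-- of positive parts) whose largest part is ≤ m.  `fuel` only ensures
-- termination; it is always called with fuel = n, which suffices.
partitionsBounded : ℕ → ℕ → ℕ → List (List ℕ)
partitionsBounded _        zero    _ = [] ∷ []
partitionsBounded zero     (suc n) _ = []
partitionsBounded (suc f) (suc n) m =
  concatMap (λ k → map (suc k ∷_) (partitionsBounded f (suc n ∸ suc k) (suc k)))
            (filterᵇ (λ k → (suc k ≤ᵇ suc n) ∧ (suc k ≤ᵇ m)) (upTo (suc n)))

partitions : ℕ → List (List ℕ)
partitions n = partitionsBounded n n n

distinctParts : List ℕ → Bool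
distinctParts []           = true
distinctParts (x ∷ [])     = true
distinctParts (x ∷ y ∷ l)  = (y <ᵇ x) ∧ distinctParts (y ∷ l)

q : ℕ → ℕ
q n = length (filterᵇ distinctParts (partitions n))

-- s(n) = q(n) - 2 q(n-1) + q(n-2), with q(-1) = q(-2) = 0
s : ℕ → ℤ
s zero          = + q 0
s (suc zero)    = + q 1 ℤ.- + (2 ℕ.* q 0)
  where import Data.Nat as ℕ
s (suc (suc n)) = + q (suc (suc n)) ℤ.- + (2 ℕ.* q (suc n)) ℤ.+ + q n
  where import Data.Nat as ℕ

consecStep : List ℕ → Bool
consecStep []          = true
consecStep (x ∷ [])    = true
consecStep (x ∷ y ∷ l) = ((x ≡ᵇ y) ∨ (x ≡ᵇ suc y)) ∧ consecStep (y ∷ l)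

topTwoEqual : List ℕ → Bool
topTwoEqual (x ∷ y ∷ _) = x ≡ᵇ y
topTwoEqual _           = false

endsIn321 : List ℕ → Bool
endsIn321 l with reverse l
... | 1 ∷ 2 ∷ 3 ∷ _ = true
... | _             = false

special : List ℕ → Bool
special l = (4 ≤ᵇ length l) ∧ consecStep l ∧ topTwoEqual l ∧ endsIn321 l

specialCount : ℕ → ℕ
specialCount n = length (filterᵇ special (partitions n))

-- Removing the staircase k, k − 1, …, 1 from a partition into k distinct parts and conjugating
-- gives q(n) = Σₖ p(n − Tₖ | parts in [1, k]), where Tₖ is the k-th triangular number. Splitting
-- off a part 1 turns the first difference q(n) − q(n − 1) into Σₖ p(n − Tₖ | parts in [2, k]).
-- In the next difference, splitting off a largest part and then a part 2 makes the two sums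
-- telescope (for n ≥ 6 the boundary terms match up), leaving Σ_y p(n − 2y − T_{y−1} | parts in [3, y]).
-- This counts the partitions of the statement: such a partition consists of y twice, y − 1, …, 2, 1
-- once each, and further parts in [3, y].

module Submission where

open import Defs
open import Algebra.Bundles using (CommutativeMonoid)
open import Data.Bool using (Bool; true; false; T; _∧_; _∨_)
open import Data.Bool.Properties
  using (T-≡; ∧-assoc; ∧-comm; ∧-commutativeMonoid; ∧-distribˡ-∨; ∧-identityʳ; ∧-zeroʳ; ∨-identityʳ; ∨-zeroʳ)
open import Data.Integer using (ℤ; +_; -[1+_]; _-_)
import Data.Integer as ℤ
import Data.Integer.Properties as ℤP
open import Data.Integer.Tactic.RingSolver using (solve-∀)
open import Data.List using (List; []; _∷_; _++_; _∷ʳ_; length; map; concatMap; filterᵇ; applyUpTo; reverse; null)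
open import Data.List.Properties using (unfold-reverse; length-reverse)
open import Data.Nat using (ℕ; zero; suc; _+_; _*_; _∸_; _⊓_; _≤_; _<_; _≤ᵇ_; _<ᵇ_; _≡ᵇ_; z≤n; s≤s)
open import Data.Nat.Properties
import Data.Nat.Tactic.RingSolver as ℕ-Solver
open import Algebra.Properties.CommutativeSemigroup +-commutativeSemigroup using (interchange; xy∙z≈xz∙y)
open import Algebra.Properties.CommutativeSemigroup (CommutativeMonoid.commutativeSemigroup ∧-commutativeMonoid)
  using () renaming (xy∙z≈y∙xz to ∧-xy∙z≈y∙xz)
open import Data.Sum using (inj₁; inj₂)
open import Function using (_∘_)
open import Function.Bundles using (Equivalence)
open import Relation.Binary.Definitions using (tri<; tri≈; tri>)
open import Relation.Binary.PropositionalEquality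
open import Relation.Nullary using (yes; no; contradiction)
open ≡-Reasoning

≤⇒≤ᵇ≡true : ∀ {m n} → m ≤ n → (m ≤ᵇ n) ≡ true
≤⇒≤ᵇ≡true m≤n = Equivalence.to T-≡ (≤⇒≤ᵇ m≤n)

>⇒≤ᵇ≡false : ∀ {m n} → n < m → (m ≤ᵇ n) ≡ false
>⇒≤ᵇ≡false {m} {n} n<m with m ≤ᵇ n in eq
... | false = refl
... | true  = contradiction (≤ᵇ⇒≤ m n (subst T (sym eq) _)) (<⇒≱ n<m)

≡ᵇ-refl : ∀ n → (n ≡ᵇ n) ≡ true
≡ᵇ-refl n = Equivalence.to T-≡ (≡⇒≡ᵇ n n refl)

≢⇒≡ᵇ≡false : ∀ {m n} → m ≢ n → (m ≡ᵇ n) ≡ false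
≢⇒≡ᵇ≡false {m} {n} m≢n with m ≡ᵇ n in eq
... | false = refl
... | true  = contradiction (≡ᵇ⇒≡ m n (subst T (sym eq) _)) m≢n

<ᵇ-suc : ∀ m n → (m <ᵇ suc n) ≡ (m ≤ᵇ n)
<ᵇ-suc zero    n = refl
<ᵇ-suc (suc m) n = refl

≤ᵇ-split : ∀ k m → (k ≤ᵇ m) ≡ ((m ≡ᵇ k) ∨ (suc k ≤ᵇ m))
≤ᵇ-split zero    zero    = refl
≤ᵇ-split zero    (suc m) = refl
≤ᵇ-split (suc k) zero    = refl
≤ᵇ-split (suc k) (suc m) = trans (<ᵇ-suc k m) (≤ᵇ-split k m)

≡ᵇ∧<ᵇ≡false : ∀ m k → ((m ≡ᵇ k) ∧ (k <ᵇ m)) ≡ false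
≡ᵇ∧<ᵇ≡false zero    zero    = refl
≡ᵇ∧<ᵇ≡false zero    (suc k) = refl
≡ᵇ∧<ᵇ≡false (suc m) zero    = refl
≡ᵇ∧<ᵇ≡false (suc m) (suc k) = ≡ᵇ∧<ᵇ≡false m k

∧-zeroʳ′ : ∀ x {y} → y ≡ false → (x ∧ y) ≡ y
∧-zeroʳ′ x refl = ∧-zeroʳ x


infixr 7 [_]·_

[_]·_ : Bool → ℕ → ℕ
[ true  ]· x = x
[ false ]· _ = 0

[]·-zero : ∀ b → [ b ]· 0 ≡ 0
[]·-zero true  = refl
[]·-zero false = refl

[<ᵇ]·-⊓ : ∀ i m j x → [ i <ᵇ m ]· [ i <ᵇ j ]· x ≡ [ i <ᵇ m ⊓ j ]· x
[<ᵇ]·-⊓ i       zero    j       x = refl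
[<ᵇ]·-⊓ zero    (suc m) zero    x = refl
[<ᵇ]·-⊓ zero    (suc m) (suc j) x = refl
[<ᵇ]·-⊓ (suc i) (suc m) zero    x = []·-zero (i <ᵇ m)
[<ᵇ]·-⊓ (suc i) (suc m) (suc j) x = [<ᵇ]·-⊓ i m j x

δ₀ : ℤ → ℕ
δ₀ (+ zero) = 1
δ₀ _        = 0


[+m]-[+n]≡+[m∸n] : ∀ {m n} → n ≤ m → + m - + n ≡ + (m ∸ n)
[+m]-[+n]≡+[m∸n] {m} {n} n≤m = trans (ℤP.[+m]-[+n]≡m⊖n m n) (ℤP.⊖-≥ n≤m)

[+m]-[+n]≡-[1+n∸1+m] : ∀ {m n} → m < n → + m - + n ≡ -[1+ n ∸ suc m ]
[+m]-[+n]≡-[1+n∸1+m] {m} {n} m<n =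
  trans (ℤP.[+m]-[+n]≡m⊖n m n) (trans (ℤP.⊖-< m<n) (cong (λ k → ℤ.- + k) (+-∸-assoc 1 m<n)))

[1+m]-[1+n]≡m-n : ∀ m n → + suc m - + suc n ≡ + m - + n
[1+m]-[1+n]≡m-n m n = trans (ℤP.[+m]-[+n]≡m⊖n (suc m) (suc n)) (trans (ℤP.[1+m]⊖[1+n]≡m⊖n m n) (sym (ℤP.[+m]-[+n]≡m⊖n m n)))

+[m∸n]≡[1+m]-[1+n] : ∀ {m n} → n ≤ m → + (m ∸ n) ≡ + suc m - + suc n
+[m∸n]≡[1+m]-[1+n] {m} {n} n≤m = sym (trans ([1+m]-[1+n]≡m-n m n) ([+m]-[+n]≡+[m∸n] n≤m))

[1+m]-[1+n]≤m : ∀ m n → + suc m - + suc n ℤ.≤ + m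
[1+m]-[1+n]≤m m n = subst (ℤ._≤ + m) (sym (trans ([1+m]-[1+n]≡m-n m n) (ℤP.[+m]-[+n]≡m⊖n m n))) (ℤP.m⊖n≤m m n)

δ₀-≢ : ∀ a b → a ≢ b → δ₀ (+ a - + b) ≡ 0
δ₀-≢ a b a≢b with <-cmp a b
... | tri< a<b _ _ = cong δ₀ ([+m]-[+n]≡-[1+n∸1+m] a<b)
... | tri≈ _ a≡b _ = contradiction a≡b a≢b
... | tri> _ _ b<a = trans (cong δ₀ ([+m]-[+n]≡+[m∸n] (<⇒≤ b<a))) (cong (δ₀ ∘ +_) (+-∸-assoc 1 b<a))

-[a+b]≡-a-b : ∀ (N a b : ℤ) → N - (a ℤ.+ b) ≡ N - a - b
-[a+b]≡-a-b = solve-∀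

-a-b≡-b-a : ∀ (N a b : ℤ) → N - a - b ≡ N - b - a
-a-b≡-b-a = solve-∀

+a-+b++c≡+d : ∀ {a b c d} → a + c ≡ b + d → + a - + b ℤ.+ + c ≡ + d
+a-+b++c≡+d {a} {b} {c} {d} a+c≡b+d = begin
  + a - + b ℤ.+ + c  ≡⟨ rearrange (+ a) (+ b) (+ c) ⟩
  + (a + c) - + b    ≡⟨ cong (λ k → + k - + b) a+c≡b+d ⟩
  + (b + d) - + b    ≡⟨ cancel (+ b) (+ d) ⟩
  + d                ∎
  where
  rearrange : ∀ (a b c : ℤ) → a - b ℤ.+ c ≡ (a ℤ.+ c) - b
  rearrange = solve-∀
  cancel : ∀ (b d : ℤ) → (b ℤ.+ d) - b ≡ d
  cancel = solve-∀


∑ : ℕ → (ℕ → ℕ) → ℕ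
∑ zero    f = 0
∑ (suc n) f = ∑ n f + f n

syntax ∑ n (λ i → e) = ∑[ i < n ] e

∑-cong : ∀ {f g : ℕ → ℕ} n → (∀ i → i < n → f i ≡ g i) → ∑ n f ≡ ∑ n g
∑-cong zero    f≗g = refl
∑-cong (suc n) f≗g = cong₂ _+_ (∑-cong n (λ i i<n → f≗g i (m≤n⇒m≤1+n i<n))) (f≗g n ≤-refl)

∑-distrib-+ : ∀ (f g : ℕ → ℕ) n → ∑[ i < n ] (f i + g i) ≡ ∑ n f + ∑ n g
∑-distrib-+ f g zero    = refl
∑-distrib-+ f g (suc n) = trans (cong (_+ (f n + g n)) (∑-distrib-+ f g n)) (interchange (∑ n f) (∑ n g) (f n) (g n))

∑-zero : ∀ {f : ℕ → ℕ} n → (∀ i → i < n → f i ≡ 0) → ∑ n f ≡ 0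
∑-zero zero    f≗0 = refl
∑-zero (suc n) f≗0 = cong₂ _+_ (∑-zero n (λ i i<n → f≗0 i (m≤n⇒m≤1+n i<n))) (f≗0 n ≤-refl)

∑-comm : ∀ (F : ℕ → ℕ → ℕ) m n → ∑[ i < m ] ∑ n (F i) ≡ ∑[ j < n ] ∑[ i < m ] F i j
∑-comm F zero    n = sym (∑-zero n (λ _ _ → refl))
∑-comm F (suc m) n = begin
  ∑[ i < m ] ∑ n (F i) + ∑ n (F m)           ≡⟨ cong (_+ ∑ n (F m)) (∑-comm F m n) ⟩
  ∑[ j < n ] ∑[ i < m ] F i j + ∑ n (F m)    ≡⟨ ∑-distrib-+ (λ j → ∑[ i < m ] F i j) (F m) n ⟨
  ∑[ j < n ] (∑[ i < m ] F i j + F m j)      ∎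

∑-head : ∀ (f : ℕ → ℕ) n → ∑ (suc n) f ≡ f 0 + ∑[ i < n ] f (suc i)
∑-head f zero    = +-comm 0 (f 0)
∑-head f (suc n) = trans (cong (_+ f (suc n)) (∑-head f n)) (+-assoc (f 0) _ _)

∑-pad : ∀ (f : ℕ → ℕ) m d → (∀ i → m ≤ i → f i ≡ 0) → ∑ (m + d) f ≡ ∑ m f
∑-pad f m zero    f≗0 = cong (λ k → ∑ k f) (+-identityʳ m)
∑-pad f m (suc d) f≗0 = begin
  ∑ (m + suc d) f         ≡⟨ cong (λ k → ∑ k f) (+-suc m d) ⟩
  ∑ (m + d) f + f (m + d) ≡⟨ cong₂ _+_ (∑-pad f m d f≗0) (f≗0 (m + d) (m≤m+n m d)) ⟩
  ∑ m f + 0               ≡⟨ +-identityʳ _ ⟩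
  ∑ m f                   ∎

∑-[<ᵇ]· : ∀ (f : ℕ → ℕ) m n → ∑[ i < m ] ([ i <ᵇ n ]· f i) ≡ ∑ (m ⊓ n) f
∑-[<ᵇ]· f zero    n = refl
∑-[<ᵇ]· f (suc m) n with m <? n
... | yes m<n = begin
  ∑[ i < m ] ([ i <ᵇ n ]· f i) + [ m <ᵇ n ]· f m ≡⟨ cong₂ _+_ (∑-[<ᵇ]· f m n) (cong ([_]· f m) (≤⇒≤ᵇ≡true m<n)) ⟩
  ∑ (m ⊓ n) f + f m                             ≡⟨ cong (λ k → ∑ k f + f m) (m≤n⇒m⊓n≡m (<⇒≤ m<n)) ⟩
  ∑ (suc m) f                                   ≡⟨ cong (λ k → ∑ k f) (m≤n⇒m⊓n≡m m<n) ⟨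
  ∑ (suc m ⊓ n) f                               ∎
... | no m≮n = begin
  ∑[ i < m ] ([ i <ᵇ n ]· f i) + [ m <ᵇ n ]· f m ≡⟨ cong₂ _+_ (∑-[<ᵇ]· f m n) (cong ([_]· f m) (>⇒≤ᵇ≡false (s≤s n≤m))) ⟩
  ∑ (m ⊓ n) f + 0                               ≡⟨ +-identityʳ _ ⟩
  ∑ (m ⊓ n) f                                   ≡⟨ cong (λ k → ∑ k f) (trans (m≥n⇒m⊓n≡n n≤m) (sym (m≥n⇒m⊓n≡n (m≤n⇒m≤1+n n≤m)))) ⟩
  ∑ (suc m ⊓ n) f                               ∎
  where n≤m = ≮⇒≥ m≮n

∑-⊓ : ∀ (f : ℕ → ℕ) m n → (∀ i → m ≤ i → f i ≡ 0) → ∑ (m ⊓ n) f ≡ ∑ n f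
∑-⊓ f m n f≗0 with ≤-total m n
... | inj₂ n≤m = cong (λ k → ∑ k f) (m≥n⇒m⊓n≡n n≤m)
... | inj₁ m≤n = begin
  ∑ (m ⊓ n) f       ≡⟨ cong (λ k → ∑ k f) (m≤n⇒m⊓n≡m m≤n) ⟩
  ∑ m f             ≡⟨ ∑-pad f m (n ∸ m) f≗0 ⟨
  ∑ (m + (n ∸ m)) f ≡⟨ cong (λ k → ∑ k f) (m+[n∸m]≡n m≤n) ⟩
  ∑ n f             ∎

∑-[≡ᵇ]· : ∀ (f : ℕ → ℕ) i n → ∑[ j < n ] ([ i ≡ᵇ j ]· f j) ≡ [ i <ᵇ n ]· f i
∑-[≡ᵇ]· f i zero    = refl
∑-[≡ᵇ]· f i (suc n) with <-cmp i n
... | tri< i<n _ _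
  rewrite ∑-[≡ᵇ]· f i n | ≤⇒≤ᵇ≡true i<n | ≢⇒≡ᵇ≡false (<⇒≢ i<n) | ≤⇒≤ᵇ≡true (m≤n⇒m≤1+n i<n) = +-identityʳ (f i)
... | tri≈ _ refl _
  rewrite ∑-[≡ᵇ]· f i i | >⇒≤ᵇ≡false {suc i} {i} ≤-refl | ≡ᵇ-refl i | ≤⇒≤ᵇ≡true (n<1+n i) = refl
... | tri> _ _ n<i
  rewrite ∑-[≡ᵇ]· f i n | >⇒≤ᵇ≡false {suc i} {n} (<⇒≤ (s≤s n<i)) | ≢⇒≡ᵇ≡false (≢-sym (<⇒≢ n<i)) | >⇒≤ᵇ≡false {suc i} {suc n} (s≤s n<i) = refl


-- Partitions in a box

-- box lo r s N is the number of partitions of N into at most r parts, each in [lo, s]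
-- (zero when N < 0), computed by splitting on whether s occurs as a part.
box : ℕ → ℕ → ℕ → ℤ → ℕ
box lo r       s       -[1+ _ ] = 0
box lo zero    s       (+ N)    = δ₀ (+ N)
box lo (suc r) zero    (+ N)    = δ₀ (+ N)
box lo (suc r) (suc s) (+ N)    = box lo (suc r) s (+ N) + [ lo ≤ᵇ suc s ]· box lo r (suc s) (+ N - + suc s)

box-no-parts : ∀ lo s N → box lo 0 s N ≡ δ₀ N
box-no-parts lo s (+ N)    = refl
box-no-parts lo s -[1+ N ] = refl

box-size-zero : ∀ lo r N → box lo r 0 N ≡ δ₀ N
box-size-zero lo zero    N        = box-no-parts lo 0 N
box-size-zero lo (suc r) (+ N)    = refl
box-size-zero lo (suc r) -[1+ N ] = refl

box-step : ∀ lo r s N →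
  box lo (suc r) (suc s) N ≡ box lo (suc r) s N + [ lo ≤ᵇ suc s ]· box lo r (suc s) (N - + suc s)
box-step lo r s (+ N)    = refl
box-step lo r s -[1+ N ] = sym ([]·-zero (lo ≤ᵇ suc s))

box-step⁺ : ∀ {lo} r s N → lo ≤ suc s →
  box lo (suc r) (suc s) N ≡ box lo (suc r) s N + box lo r (suc s) (N - + suc s)
box-step⁺ {lo} r s N lo≤s =
  trans (box-step lo r s N) (cong (λ b → box lo (suc r) s N + [ b ]· box lo r (suc s) (N - + suc s)) (≤⇒≤ᵇ≡true lo≤s))

box-of-zero : ∀ lo r s → box lo r s (+ 0) ≡ 1
box-of-zero lo zero    s       = refl
box-of-zero lo (suc r) zero    = refl
box-of-zero lo (suc r) (suc s) = cong₂ _+_ (box-of-zero lo (suc r) s) ([]·-zero (lo ≤ᵇ suc s))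

box-of-negative : ∀ lo r s {a b} → a < b → box lo r s (+ a - + b) ≡ 0
box-of-negative lo r s a<b rewrite [+m]-[+n]≡-[1+n∸1+m] a<b = refl

box-below : ∀ lo r s N → s < lo → box lo r s N ≡ δ₀ N
box-below lo zero    s       N s<lo = box-no-parts lo s N
box-below lo (suc r) zero    N s<lo = box-size-zero lo (suc r) N
box-below lo (suc r) (suc s) N s<lo = begin
  box lo (suc r) (suc s) N                                         ≡⟨ box-step lo r s N ⟩
  box lo (suc r) s N + [ lo ≤ᵇ suc s ]· box lo r (suc s) (N - + suc s)
    ≡⟨ cong₂ _+_ (box-below lo (suc r) s N (<-trans (n<1+n s) s<lo)) (cong ([_]· box lo r (suc s) (N - + suc s)) (>⇒≤ᵇ≡false s<lo)) ⟩
  δ₀ N + 0                                                         ≡⟨ +-identityʳ (δ₀ N) ⟩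
  δ₀ N                                                             ∎

box-parts-suc : ∀ lo r s N → N ≤ r → box lo r s (+ N) ≡ box lo (suc r) s (+ N)
box-parts-suc lo zero    s       .zero z≤n = sym (box-of-zero lo 1 s)
box-parts-suc lo (suc r) zero    N     N≤r = refl
box-parts-suc lo (suc r) (suc s) N     N≤r =
  cong₂ _+_ (box-parts-suc lo (suc r) s N N≤r) (cong ([ lo ≤ᵇ suc s ]·_) rest)
  where
  rest : box lo r (suc s) (+ N - + suc s) ≡ box lo (suc r) (suc s) (+ N - + suc s)
  rest with suc s ≤? N
  ... | no  s≮N rewrite [+m]-[+n]≡-[1+n∸1+m] (≰⇒> s≮N) = refl
  ... | yes s<N rewrite [+m]-[+n]≡+[m∸n] s<N = box-parts-suc lo r (suc s) (N ∸ suc s) (≤-trans (∸-monoʳ-≤ N (s≤s z≤n)) (∸-monoˡ-≤ 1 N≤r))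

box-parts-+ : ∀ lo r d s N → N ≤ r → box lo r s (+ N) ≡ box lo (r + d) s (+ N)
box-parts-+ lo r zero    s N N≤r = cong (λ k → box lo k s (+ N)) (sym (+-identityʳ r))
box-parts-+ lo r (suc d) s N N≤r = begin
  box lo r s (+ N)             ≡⟨ box-parts-+ lo r d s N N≤r ⟩
  box lo (r + d) s (+ N)       ≡⟨ box-parts-suc lo (r + d) s N (≤-trans N≤r (m≤m+n r d)) ⟩
  box lo (suc (r + d)) s (+ N) ≡⟨ cong (λ k → box lo k s (+ N)) (+-suc r d) ⟨
  box lo (r + suc d) s (+ N)   ∎

-- Allowing ∣ N ∣ parts is no restriction, so this counts the partitions of N with parts in [lo, s].
parts[_,_]_ : ℕ → ℕ → ℤ → ℕ
parts[ lo , s ] N = box lo ℤ.∣ N ∣ s N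

box≡parts : ∀ lo r s N → N ℤ.≤ + r → box lo r s N ≡ parts[ lo , s ] N
box≡parts lo r s -[1+ k ] _             = refl
box≡parts lo r s (+ c)    (ℤ.+≤+ c≤r) = begin
  box lo r s (+ c)             ≡⟨ cong (λ k → box lo k s (+ c)) (m+[n∸m]≡n c≤r) ⟨
  box lo (c + (r ∸ c)) s (+ c) ≡⟨ box-parts-+ lo c (r ∸ c) s c ≤-refl ⟨
  parts[ lo , s ] (+ c)        ∎

parts-step : ∀ lo s N → lo ≤ suc s →
  parts[ lo , suc s ] N ≡ parts[ lo , s ] N + parts[ lo , suc s ] (N - + suc s)
parts-step lo s -[1+ k ] _      = refl
parts-step lo s (+ zero) _      = refl
parts-step lo s (+ suc M) lo≤s =
  trans (box-step⁺ M s (+ suc M) lo≤s)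
        (cong (_+_ (parts[ lo , s ] (+ suc M))) (box≡parts lo M (suc s) _ ([1+m]-[1+n]≤m M s)))

parts-below : ∀ lo s N → s < lo → parts[ lo , s ] N ≡ δ₀ N
parts-below lo s N = box-below lo ℤ.∣ N ∣ s N

box-raise-min : ∀ l r s N → suc l ≤ s →
  box (suc l) (suc r) s N ≡ box (suc (suc l)) (suc r) s N + box (suc l) r s (N - + suc l)
box-raise-min l r (suc s) N (s≤s l≤s) with m≤n⇒m<n∨m≡n l≤s
... | inj₂ refl = begin
  box (suc l) (suc r) (suc l) N
    ≡⟨ box-step⁺ r l N ≤-refl ⟩
  box (suc l) (suc r) l N + box (suc l) r (suc l) (N - + suc l)
    ≡⟨ cong (_+ box (suc l) r (suc l) (N - + suc l)) (trans (box-below (suc l) (suc r) l N (n<1+n l))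
                                                               (sym (box-below (suc (suc l)) (suc r) (suc l) N (n<1+n (suc l))))) ⟩
  box (suc (suc l)) (suc r) (suc l) N + box (suc l) r (suc l) (N - + suc l) ∎
... | inj₁ l<s = begin
  box lo (suc r) (suc s) N
    ≡⟨ box-step⁺ r s N lo≤1+s ⟩
  box lo (suc r) s N + box lo r (suc s) (N - + suc s)
    ≡⟨ cong (_+ box lo r (suc s) (N - + suc s)) (box-raise-min l r s N l<s) ⟩
  (box lo′ (suc r) s N + box lo r s (N - + lo)) + box lo r (suc s) (N - + suc s)
    ≡⟨ regroup r ⟩
  (box lo′ (suc r) s N + box lo′ r (suc s) (N - + suc s)) + box lo r (suc s) (N - + lo)
    ≡⟨ cong (_+ box lo r (suc s) (N - + lo)) (box-step⁺ r s N (s≤s l<s)) ⟨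
  box lo′ (suc r) (suc s) N + box lo r (suc s) (N - + lo) ∎
  where
  lo lo′ : ℕ
  lo  = suc l
  lo′ = suc (suc l)
  lo≤1+s : lo ≤ suc s
  lo≤1+s = m≤n⇒m≤1+n l<s
  regroup : ∀ r → (box lo′ (suc r) s N + box lo r s (N - + lo)) + box lo r (suc s) (N - + suc s)
                ≡ (box lo′ (suc r) s N + box lo′ r (suc s) (N - + suc s)) + box lo r (suc s) (N - + lo)
  regroup zero = begin
    (A + box lo 0 s (N - + lo)) + box lo 0 (suc s) (N - + suc s)
      ≡⟨ cong₂ (λ a b → (A + a) + b) (box-no-parts lo s (N - + lo)) (box-no-parts lo (suc s) (N - + suc s)) ⟩
    (A + δ₀ (N - + lo)) + δ₀ (N - + suc s)
      ≡⟨ xy∙z≈xz∙y A (δ₀ (N - + lo)) (δ₀ (N - + suc s)) ⟩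
    (A + δ₀ (N - + suc s)) + δ₀ (N - + lo)
      ≡⟨ cong₂ (λ a b → (A + a) + b) (box-no-parts lo′ (suc s) (N - + suc s)) (box-no-parts lo (suc s) (N - + lo)) ⟨
    (A + box lo′ 0 (suc s) (N - + suc s)) + box lo 0 (suc s) (N - + lo) ∎
    where A = box lo′ 1 s N
  regroup (suc r′) = begin
    (A + B) + box lo (suc r′) (suc s) (N - + suc s)
      ≡⟨ cong (_+_ (A + B)) (box-raise-min l r′ (suc s) (N - + suc s) lo≤1+s) ⟩
    (A + B) + (C + box lo r′ (suc s) (N - + suc s - + lo))
      ≡⟨ cong (λ z → (A + B) + (C + box lo r′ (suc s) z)) (-a-b≡-b-a N (+ suc s) (+ lo)) ⟩
    (A + B) + (C + box lo r′ (suc s) (N - + lo - + suc s))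
      ≡⟨ interchange A B C _ ⟩
    (A + C) + (B + box lo r′ (suc s) (N - + lo - + suc s))
      ≡⟨ cong (_+_ (A + C)) (box-step⁺ r′ s (N - + lo) lo≤1+s) ⟨
    (A + C) + box lo (suc r′) (suc s) (N - + lo) ∎
    where
    A = box lo′ (suc (suc r′)) s N
    B = box lo (suc r′) s (N - + lo)
    C = box lo′ (suc r′) (suc s) (N - + suc s)

parts-raise-min : ∀ l s N → suc l ≤ s →
  parts[ suc l , s ] N ≡ parts[ suc (suc l) , s ] N + parts[ suc l , s ] (N - + suc l)
parts-raise-min l s -[1+ k ] _   = refl
parts-raise-min l s (+ zero) _   = refl
parts-raise-min l s (+ suc M) l<s =
  trans (box-raise-min l M s (+ suc M) l<s)
        (cong (_+_ (parts[ suc (suc l) , s ] (+ suc M))) (box≡parts (suc l) M s _ ([1+m]-[1+n]≤m M l)))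

box₁-step : ∀ r s N → box 1 (suc r) (suc s) N ≡ box 1 (suc r) s N + box 1 r (suc s) (N - + suc s)
box₁-step r s N = box-step⁺ r s N (s≤s z≤n)

box₁-width-one : ∀ r N → δ₀ N + box 1 r 1 (N - + 1) ≡ box 1 r 1 N + δ₀ (N - + suc r)
box₁-width-one zero    N rewrite box-no-parts 1 1 N | box-no-parts 1 1 (N - + 1) = refl
box₁-width-one (suc r) N = begin
  δ₀ N + box 1 (suc r) 1 (N - + 1)                         ≡⟨ cong (_+_ (δ₀ N)) (column (N - + 1)) ⟩
  δ₀ N + (δ₀ (N - + 1) + box 1 r 1 (N - + 1 - + 1))        ≡⟨ cong (_+_ (δ₀ N)) (box₁-width-one r (N - + 1)) ⟩
  δ₀ N + (box 1 r 1 (N - + 1) + δ₀ (N - + 1 - + suc r))    ≡⟨ +-assoc (δ₀ N) _ _ ⟨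
  (δ₀ N + box 1 r 1 (N - + 1)) + δ₀ (N - + 1 - + suc r)
    ≡⟨ cong₂ _+_ (sym (column N)) (cong δ₀ (sym (-[a+b]≡-a-b N (+ 1) (+ suc r)))) ⟩
  box 1 (suc r) 1 N + δ₀ (N - + suc (suc r))               ∎
  where
  column : ∀ N → box 1 (suc r) 1 N ≡ δ₀ N + box 1 r 1 (N - + 1)
  column N = trans (box₁-step r 0 N) (cong (_+ box 1 r 1 (N - + 1)) (box-size-zero 1 (suc r) N))

box₁-one-part : ∀ s N → box 1 1 s N + δ₀ (N - + suc s) ≡ δ₀ N + box 1 1 s (N - + 1)
box₁-one-part zero    N rewrite box-size-zero 1 1 N | box-size-zero 1 1 (N - + 1) = refl
box₁-one-part (suc s) N = begin
  box 1 1 (suc s) N + δ₀ (N - + suc (suc s))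
    ≡⟨ cong₂ _+_ (row N) (cong δ₀ (-[a+b]≡-a-b N (+ 1) (+ suc s))) ⟩
  (box 1 1 s N + δ₀ (N - + suc s)) + δ₀ (N - + 1 - + suc s) ≡⟨ cong (_+ δ₀ (N - + 1 - + suc s)) (box₁-one-part s N) ⟩
  (δ₀ N + box 1 1 s (N - + 1)) + δ₀ (N - + 1 - + suc s)     ≡⟨ +-assoc (δ₀ N) _ _ ⟩
  δ₀ N + (box 1 1 s (N - + 1) + δ₀ (N - + 1 - + suc s))     ≡⟨ cong (_+_ (δ₀ N)) (row (N - + 1)) ⟨
  δ₀ N + box 1 1 (suc s) (N - + 1)                           ∎
  where
  row : ∀ N → box 1 1 (suc s) N ≡ box 1 1 s N + δ₀ (N - + suc s)
  row N = trans (box₁-step 0 s N) (cong (_+_ (box 1 1 s N)) (box-no-parts 1 (suc s) (N - + suc s)))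

box₁-step-parts : ∀ r s N → box 1 (suc r) (suc s) N ≡ box 1 r (suc s) N + box 1 (suc r) s (N - + suc r)
box₁-step-parts zero s N = begin
  box 1 1 (suc s) N                  ≡⟨ trans (box₁-step 0 s N) (cong (_+_ (box 1 1 s N)) (box-no-parts 1 (suc s) (N - + suc s))) ⟩
  box 1 1 s N + δ₀ (N - + suc s)     ≡⟨ box₁-one-part s N ⟩
  δ₀ N + box 1 1 s (N - + 1)         ≡⟨ cong (_+ box 1 1 s (N - + 1)) (box-no-parts 1 (suc s) N) ⟨
  box 1 0 (suc s) N + box 1 1 s (N - + 1) ∎
box₁-step-parts (suc r) zero N = begin
  box 1 (suc (suc r)) 1 N              ≡⟨ trans (box₁-step (suc r) 0 N) (cong (_+ box 1 (suc r) 1 (N - + 1)) (box-size-zero 1 (suc (suc r)) N)) ⟩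
  δ₀ N + box 1 (suc r) 1 (N - + 1)     ≡⟨ box₁-width-one (suc r) N ⟩
  box 1 (suc r) 1 N + δ₀ (N - + suc (suc r))
    ≡⟨ cong (_+_ (box 1 (suc r) 1 N)) (box-size-zero 1 (suc (suc r)) (N - + suc (suc r))) ⟨
  box 1 (suc r) 1 N + box 1 (suc (suc r)) 0 (N - + suc (suc r)) ∎
box₁-step-parts (suc r) (suc s) N = begin
  box 1 R S N
    ≡⟨ box₁-step (suc r) (suc s) N ⟩
  box 1 R (suc s) N + box 1 (suc r) S (N - + S)
    ≡⟨ cong₂ _+_ (box₁-step-parts (suc r) s N) (box₁-step-parts r (suc s) (N - + S)) ⟩
  (box 1 (suc r) (suc s) N + box 1 R s (N - + R)) + (box 1 r S (N - + S) + box 1 (suc r) (suc s) (N - + S - + suc r))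
    ≡⟨ cong (λ z → (box 1 (suc r) (suc s) N + box 1 R s (N - + R)) + (box 1 r S (N - + S) + box 1 (suc r) (suc s) z)) (commute N) ⟩
  (box 1 (suc r) (suc s) N + box 1 R s (N - + R)) + (box 1 r S (N - + S) + box 1 (suc r) (suc s) (N - + R - + suc s))
    ≡⟨ interchange (box 1 (suc r) (suc s) N) (box 1 R s (N - + R)) (box 1 r S (N - + S)) _ ⟩
  (box 1 (suc r) (suc s) N + box 1 r S (N - + S)) + (box 1 R s (N - + R) + box 1 (suc r) (suc s) (N - + R - + suc s))
    ≡⟨ cong₂ _+_ (box₁-step r (suc s) N) (box₁-step (suc r) s (N - + R)) ⟨
  box 1 (suc r) S N + box 1 R (suc s) (N - + R) ∎
  where
  R = suc (suc r)
  S = suc (suc s)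
  commute : ∀ N → N - + S - + suc r ≡ N - + R - + suc s
  commute N = begin
    N - + S - + suc r       ≡⟨ -[a+b]≡-a-b N (+ S) (+ suc r) ⟨
    N - + (S + suc r)       ≡⟨ cong (λ k → N - + suc k) (+-comm (suc s) (suc r)) ⟩
    N - + (R + suc s)       ≡⟨ -[a+b]≡-a-b N (+ R) (+ suc s) ⟩
    N - + R - + suc s       ∎

box₁-conjugate : ∀ r s N → box 1 r s N ≡ box 1 s r N
box₁-conjugate zero    zero    N = refl
box₁-conjugate zero    (suc s) N = trans (box-no-parts 1 (suc s) N) (sym (box-size-zero 1 (suc s) N))
box₁-conjugate (suc r) zero    N = trans (box-size-zero 1 (suc r) N) (sym (box-no-parts 1 (suc r) N))
box₁-conjugate (suc r) (suc s) N = begin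
  box 1 (suc r) (suc s) N                              ≡⟨ box₁-step r s N ⟩
  box 1 (suc r) s N + box 1 r (suc s) (N - + suc s)    ≡⟨ cong₂ _+_ (box₁-conjugate (suc r) s N) (box₁-conjugate r (suc s) (N - + suc s)) ⟩
  box 1 s (suc r) N + box 1 (suc s) r (N - + suc s)    ≡⟨ box₁-step-parts s r N ⟨
  box 1 (suc s) (suc r) N                              ∎


module _ {A : Set} where

  countᵇ : (A → Bool) → List A → ℕ
  countᵇ P xs = length (filterᵇ P xs)

  countᵇ-∷ : ∀ P x xs → countᵇ P (x ∷ xs) ≡ [ P x ]· 1 + countᵇ P xs
  countᵇ-∷ P x xs with P x
  ... | true  = refl
  ... | false = refl

  countᵇ-++ : ∀ P xs ys → countᵇ P (xs ++ ys) ≡ countᵇ P xs + countᵇ P ys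
  countᵇ-++ P []       ys = refl
  countᵇ-++ P (x ∷ xs) ys = begin
    countᵇ P (x ∷ xs ++ ys)                       ≡⟨ countᵇ-∷ P x (xs ++ ys) ⟩
    [ P x ]· 1 + countᵇ P (xs ++ ys)              ≡⟨ cong (_+_ ([ P x ]· 1)) (countᵇ-++ P xs ys) ⟩
    [ P x ]· 1 + (countᵇ P xs + countᵇ P ys)      ≡⟨ +-assoc ([ P x ]· 1) _ _ ⟨
    ([ P x ]· 1 + countᵇ P xs) + countᵇ P ys      ≡⟨ cong (_+ countᵇ P ys) (countᵇ-∷ P x xs) ⟨
    countᵇ P (x ∷ xs) + countᵇ P ys               ∎

  countᵇ-cong : ∀ {P Q} xs → (∀ x → P x ≡ Q x) → countᵇ P xs ≡ countᵇ Q xs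
  countᵇ-cong         []       P≗Q = refl
  countᵇ-cong {P} {Q} (x ∷ xs) P≗Q =
    trans (countᵇ-∷ P x xs) (trans (cong₂ (λ b n → [ b ]· 1 + n) (P≗Q x) (countᵇ-cong xs P≗Q)) (sym (countᵇ-∷ Q x xs)))

  countᵇ-false : ∀ xs → countᵇ (λ _ → false) xs ≡ 0
  countᵇ-false []       = refl
  countᵇ-false (x ∷ xs) = countᵇ-false xs

  countᵇ-∧ˡ : ∀ b Q xs → countᵇ (λ x → b ∧ Q x) xs ≡ [ b ]· countᵇ Q xs
  countᵇ-∧ˡ true  Q xs = refl
  countᵇ-∧ˡ false Q xs = countᵇ-false xs

  countᵇ-∨ : ∀ P Q xs → (∀ x → (P x ∧ Q x) ≡ false) →
             countᵇ (λ x → P x ∨ Q x) xs ≡ countᵇ P xs + countᵇ Q xs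
  countᵇ-∨ P Q []       disjoint = refl
  countᵇ-∨ P Q (x ∷ xs) disjoint = begin
    countᵇ (λ x → P x ∨ Q x) (x ∷ xs)
      ≡⟨ countᵇ-∷ (λ x → P x ∨ Q x) x xs ⟩
    [ P x ∨ Q x ]· 1 + countᵇ (λ x → P x ∨ Q x) xs
      ≡⟨ cong₂ _+_ (head (P x) (Q x) (disjoint x)) (countᵇ-∨ P Q xs disjoint) ⟩
    ([ P x ]· 1 + [ Q x ]· 1) + (countᵇ P xs + countᵇ Q xs)
      ≡⟨ interchange ([ P x ]· 1) ([ Q x ]· 1) (countᵇ P xs) (countᵇ Q xs) ⟩
    ([ P x ]· 1 + countᵇ P xs) + ([ Q x ]· 1 + countᵇ Q xs)
      ≡⟨ cong₂ _+_ (countᵇ-∷ P x xs) (countᵇ-∷ Q x xs) ⟨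
    countᵇ P (x ∷ xs) + countᵇ Q (x ∷ xs) ∎
    where
    head : ∀ a b → (a ∧ b) ≡ false → [ a ∨ b ]· 1 ≡ [ a ]· 1 + [ b ]· 1
    head true  false _ = refl
    head false b     _ = refl

  countᵇ-concatMap : ∀ P (h : ℕ → List A) c (φ : ℕ → ℕ) n →
    countᵇ P (concatMap h (filterᵇ c (applyUpTo φ n))) ≡ ∑[ i < n ] ([ c (φ i) ]· countᵇ P (h (φ i)))
  countᵇ-concatMap P h c φ zero    = refl
  countᵇ-concatMap P h c φ (suc n) = trans first (sym (∑-head (λ i → [ c (φ i) ]· countᵇ P (h (φ i))) n))
    where
    first : countᵇ P (concatMap h (filterᵇ c (applyUpTo φ (suc n))))
              ≡ [ c (φ 0) ]· countᵇ P (h (φ 0)) + ∑[ i < n ] ([ c (φ (suc i)) ]· countᵇ P (h (φ (suc i))))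
    first with c (φ 0)
    ... | true  = trans (countᵇ-++ P (h (φ 0)) _) (cong (_+_ (countᵇ P (h (φ 0)))) (countᵇ-concatMap P h c (φ ∘ suc) n))
    ... | false = countᵇ-concatMap P h c (φ ∘ suc) n

countᵇ-map : ∀ {A B : Set} (P : B → Bool) (f : A → B) xs → countᵇ P (map f xs) ≡ countᵇ (P ∘ f) xs
countᵇ-map P f []       = refl
countᵇ-map P f (x ∷ xs) =
  trans (countᵇ-∷ P (f x) (map f xs)) (trans (cong (_+_ ([ P (f x) ]· 1)) (countᵇ-map P f xs)) (sym (countᵇ-∷ (P ∘ f) x xs)))

countᵇ-by-length : ∀ {B : Set} (P : List B → Bool) xs K →
  countᵇ P xs ≡ ∑[ k < K ] countᵇ (λ l → P l ∧ (length l ≡ᵇ k)) xs + countᵇ (λ l → P l ∧ (K ≤ᵇ length l)) xs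
countᵇ-by-length P xs zero    = countᵇ-cong xs (λ l → sym (∧-identityʳ (P l)))
countᵇ-by-length P xs (suc K) = begin
  countᵇ P xs
    ≡⟨ countᵇ-by-length P xs K ⟩
  S + countᵇ (λ l → P l ∧ (K ≤ᵇ length l)) xs
    ≡⟨ cong (_+_ S) (countᵇ-cong xs split) ⟩
  S + countᵇ (λ l → (P l ∧ (length l ≡ᵇ K)) ∨ (P l ∧ (suc K ≤ᵇ length l))) xs
    ≡⟨ cong (_+_ S) (countᵇ-∨ (λ l → P l ∧ (length l ≡ᵇ K)) (λ l → P l ∧ (suc K ≤ᵇ length l)) xs disjoint) ⟩
  S + (countᵇ (λ l → P l ∧ (length l ≡ᵇ K)) xs + countᵇ (λ l → P l ∧ (suc K ≤ᵇ length l)) xs)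
    ≡⟨ +-assoc S _ _ ⟨
  (S + countᵇ (λ l → P l ∧ (length l ≡ᵇ K)) xs) + countᵇ (λ l → P l ∧ (suc K ≤ᵇ length l)) xs ∎
  where
  S = ∑[ k < K ] countᵇ (λ l → P l ∧ (length l ≡ᵇ k)) xs
  split : ∀ l → (P l ∧ (K ≤ᵇ length l)) ≡ ((P l ∧ (length l ≡ᵇ K)) ∨ (P l ∧ (suc K ≤ᵇ length l)))
  split l = trans (cong (P l ∧_) (≤ᵇ-split K (length l))) (∧-distribˡ-∨ (P l) _ _)
  disjoint : ∀ l → ((P l ∧ (length l ≡ᵇ K)) ∧ (P l ∧ (suc K ≤ᵇ length l))) ≡ false
  disjoint l with P l
  ... | true  = ≡ᵇ∧<ᵇ≡false (length l) K
  ... | false = refl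

countᵇ-partitionsBounded : ∀ P f n m →
  countᵇ P (partitionsBounded (suc f) (suc n) m)
    ≡ ∑[ i < suc n ] ([ i <ᵇ m ]· countᵇ (λ l → P (suc i ∷ l)) (partitionsBounded f (n ∸ i) (suc i)))
countᵇ-partitionsBounded P f n m = begin
  countᵇ P (partitionsBounded (suc f) (suc n) m)
    ≡⟨ countᵇ-concatMap P (λ k → map (suc k ∷_) (partitionsBounded f (n ∸ k) (suc k))) (λ k → (suc k ≤ᵇ suc n) ∧ (suc k ≤ᵇ m)) (λ i → i) (suc n) ⟩
  ∑[ i < suc n ] ([ (suc i ≤ᵇ suc n) ∧ (i <ᵇ m) ]· countᵇ P (map (suc i ∷_) (partitionsBounded f (n ∸ i) (suc i))))
    ≡⟨ ∑-cong (suc n) (λ i i≤n → cong₂ (λ b x → [ b ∧ (i <ᵇ m) ]· x) (≤⇒≤ᵇ≡true i≤n) (countᵇ-map P (suc i ∷_) (partitionsBounded f (n ∸ i) (suc i)))) ⟩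
  ∑[ i < suc n ] ([ i <ᵇ m ]· countᵇ (λ l → P (suc i ∷ l)) (partitionsBounded f (n ∸ i) (suc i))) ∎

countᵇ-too-long : ∀ P f n m K → n ≤ f → n < K →
  countᵇ (λ l → P l ∧ (K ≤ᵇ length l)) (partitionsBounded f n m) ≡ 0
countᵇ-too-long P f       zero    m (suc K) _         _         =
  trans (countᵇ-∷ (λ l → P l ∧ (suc K ≤ᵇ length l)) [] []) (cong (λ b → [ b ]· 1 + 0) (∧-zeroʳ (P [])))
countᵇ-too-long P (suc f) (suc n) m (suc K) (s≤s n≤f) (s≤s n<K) = begin
  countᵇ (λ l → P l ∧ (suc K ≤ᵇ length l)) (partitionsBounded (suc f) (suc n) m)
    ≡⟨ countᵇ-partitionsBounded (λ l → P l ∧ (suc K ≤ᵇ length l)) f n m ⟩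
  ∑[ i < suc n ] ([ i <ᵇ m ]· countᵇ (λ l → P (suc i ∷ l) ∧ (K <ᵇ suc (length l))) (partitionsBounded f (n ∸ i) (suc i)))
    ≡⟨ ∑-zero (suc n) (λ i _ → trans (cong ([ i <ᵇ m ]·_) (tail i)) ([]·-zero (i <ᵇ m))) ⟩
  0 ∎
  where
  tail : ∀ i → countᵇ (λ l → P (suc i ∷ l) ∧ (K <ᵇ suc (length l))) (partitionsBounded f (n ∸ i) (suc i)) ≡ 0
  tail i = trans (countᵇ-cong (partitionsBounded f (n ∸ i) (suc i)) (λ l → cong (P (suc i ∷ l) ∧_) (<ᵇ-suc K (length l))))
                 (countᵇ-too-long (λ l → P (suc i ∷ l)) f (n ∸ i) (suc i) K (≤-trans (m∸n≤m n i) n≤f) (≤-<-trans (m∸n≤m n i) n<K))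


-- Partitions into distinct parts

triangle : ℕ → ℕ
triangle zero    = 0
triangle (suc k) = suc k + triangle k

n≤triangle : ∀ n → n ≤ triangle n
n≤triangle zero    = z≤n
n≤triangle (suc n) = m≤m+n (suc n) (triangle n)

-- Subtracting the staircase k, k − 1, …, 1 from k distinct parts ≤ b leaves k parts
-- in [0, b ∸ k], i.e. a partition with at most k parts, each ≤ b ∸ k.
distinctCount : ℤ → ℕ → ℕ → ℕ
distinctCount N b k = [ k ≤ᵇ b ]· box 1 k (b ∸ k) (N - + triangle k)

distinctCount-too-many : ∀ N {b k} → b < k → distinctCount N b k ≡ 0
distinctCount-too-many N {b} {k} b<k rewrite >⇒≤ᵇ≡false {k} {b} b<k = refl

distinctCount-negative : ∀ {a b} c k → a < b → distinctCount (+ a - + b) c k ≡ 0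
distinctCount-negative {a} {b} c k a<b = begin
  [ k ≤ᵇ c ]· box 1 k (c ∸ k) (+ a - + b - + triangle k)
    ≡⟨ cong (λ N → [ k ≤ᵇ c ]· box 1 k (c ∸ k) N) (-[a+b]≡-a-b (+ a) (+ b) (+ triangle k)) ⟨
  [ k ≤ᵇ c ]· box 1 k (c ∸ k) (+ a - + (b + triangle k))
    ≡⟨ cong ([ k ≤ᵇ c ]·_) (box-of-negative 1 k (c ∸ k) (<-≤-trans a<b (m≤m+n b (triangle k)))) ⟩
  [ k ≤ᵇ c ]· 0
    ≡⟨ []·-zero (k ≤ᵇ c) ⟩
  0 ∎

distinctCount-largest : ∀ N b k → ∑[ i < b ] distinctCount (N - + suc i) i k ≡ distinctCount N b (suc k)
distinctCount-largest N zero    k = refl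
distinctCount-largest N (suc b) k with <-cmp k b
... | tri< k<b _ _ = begin
  ∑[ i < b ] distinctCount (N - + suc i) i k + distinctCount (N - + suc b) b k
    ≡⟨ cong (_+ distinctCount (N - + suc b) b k) (distinctCount-largest N b k) ⟩
  distinctCount N b (suc k) + distinctCount (N - + suc b) b k
    ≡⟨ cong₂ _+_ smaller largest ⟩
  box 1 (suc k) t M + box 1 k (suc t) (M - + suc t)
    ≡⟨ box₁-step k t M ⟨
  box 1 (suc k) (suc t) M
    ≡⟨ whole ⟩
  distinctCount N (suc b) (suc k) ∎
  where
  t = b ∸ suc k
  M = N - + triangle (suc k)
  b∸k≡1+t : b ∸ k ≡ suc t
  b∸k≡1+t = +-∸-assoc 1 k<b
  smaller : distinctCount N b (suc k) ≡ box 1 (suc k) t M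
  smaller rewrite ≤⇒≤ᵇ≡true k<b = refl
  shift : N - + suc b - + triangle k ≡ M - + suc t
  shift = begin
    N - + suc b - + triangle k                 ≡⟨ cong (λ z → N - + suc z - + triangle k) (m∸n+n≡m k<b) ⟨
    N - + suc (t + suc k) - + triangle k       ≡⟨ commute N (+ t) (+ k) (+ triangle k) ⟩
    M - + suc t                                ∎
    where
    commute : ∀ (N t k Tk : ℤ) → N - (+ 1 ℤ.+ (t ℤ.+ (+ 1 ℤ.+ k))) - Tk ≡ N - ((+ 1 ℤ.+ k) ℤ.+ Tk) - (+ 1 ℤ.+ t)
    commute = solve-∀
  largest : distinctCount (N - + suc b) b k ≡ box 1 k (suc t) (M - + suc t)
  largest rewrite ≤⇒≤ᵇ≡true (<⇒≤ k<b) | b∸k≡1+t = cong (box 1 k (suc t)) shift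
  whole : box 1 (suc k) (suc t) M ≡ distinctCount N (suc b) (suc k)
  whole rewrite ≤⇒≤ᵇ≡true (s≤s (<⇒≤ k<b)) | b∸k≡1+t = refl
... | tri≈ _ refl _ = begin
  ∑[ i < k ] distinctCount (N - + suc i) i k + distinctCount (N - + suc k) k k
    ≡⟨ cong (_+ distinctCount (N - + suc k) k k) (distinctCount-largest N k k) ⟩
  distinctCount N k (suc k) + distinctCount (N - + suc k) k k
    ≡⟨ cong₂ _+_ (distinctCount-too-many N (n<1+n k)) all-parts ⟩
  0 + δ₀ (N - + triangle (suc k))
    ≡⟨ staircase ⟨
  distinctCount N (suc k) (suc k) ∎
  where
  all-parts : distinctCount (N - + suc k) k k ≡ δ₀ (N - + triangle (suc k))
  all-parts rewrite ≤⇒≤ᵇ≡true (≤-refl {k}) | n∸n≡0 k =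
    trans (box-size-zero 1 k _) (cong δ₀ (sym (-[a+b]≡-a-b N (+ suc k) (+ triangle k))))
  staircase : distinctCount N (suc k) (suc k) ≡ δ₀ (N - + triangle (suc k))
  staircase rewrite ≤⇒≤ᵇ≡true (≤-refl {suc k}) | n∸n≡0 k = box-size-zero 1 (suc k) _
... | tri> _ _ b<k = begin
  ∑[ i < b ] distinctCount (N - + suc i) i k + distinctCount (N - + suc b) b k
    ≡⟨ cong (_+ distinctCount (N - + suc b) b k) (distinctCount-largest N b k) ⟩
  distinctCount N b (suc k) + distinctCount (N - + suc b) b k
    ≡⟨ cong₂ _+_ (distinctCount-too-many N (m≤n⇒m≤1+n b<k)) (distinctCount-too-many (N - + suc b) b<k) ⟩
  0
    ≡⟨ distinctCount-too-many N (s≤s b<k) ⟨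
  distinctCount N (suc b) (suc k) ∎

distinctCount≡parts : ∀ n k → distinctCount (+ n) n k ≡ parts[ 1 , k ] (+ n - + triangle k)
distinctCount≡parts n k with k ≤? n
... | no  k≰n rewrite >⇒≤ᵇ≡false (≰⇒> k≰n) =
  sym (box-of-negative 1 _ k (<-≤-trans (≰⇒> k≰n) (n≤triangle k)))
... | yes k≤n rewrite ≤⇒≤ᵇ≡true k≤n = begin
  box 1 k (n ∸ k) (+ n - + triangle k)   ≡⟨ box₁-conjugate k (n ∸ k) (+ n - + triangle k) ⟩
  box 1 (n ∸ k) k (+ n - + triangle k)   ≡⟨ box≡parts 1 (n ∸ k) k (+ n - + triangle k) bound ⟩
  parts[ 1 , k ] (+ n - + triangle k)    ∎
  where
  bound : + n - + triangle k ℤ.≤ + (n ∸ k)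
  bound = ℤP.≤-trans (ℤP.+-monoʳ-≤ (+ n) (ℤP.neg-mono-≤ (ℤ.+≤+ (n≤triangle k)))) (ℤP.≤-reflexive ([+m]-[+n]≡+[m∸n] k≤n))

headAtMost : ℕ → List ℕ → Bool
headAtMost j []      = true
headAtMost j (y ∷ _) = y ≤ᵇ j

distinctParts-∷ : ∀ i l → distinctParts (suc i ∷ l) ≡ (distinctParts l ∧ headAtMost i l)
distinctParts-∷ i []      = refl
distinctParts-∷ i (y ∷ l) rewrite <ᵇ-suc y i = ∧-comm (y ≤ᵇ i) (distinctParts (y ∷ l))

boundedDistinct : ℕ → ℕ → List ℕ → Bool
boundedDistinct j k l = (distinctParts l ∧ headAtMost j l) ∧ (length l ≡ᵇ k)

boundedDistinct-∷ : ∀ j k i l → boundedDistinct j (suc k) (suc i ∷ l) ≡ ((i <ᵇ j) ∧ boundedDistinct i k l)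
boundedDistinct-∷ j k i l rewrite distinctParts-∷ i l = ∧-xy∙z≈y∙xz (distinctParts l ∧ headAtMost i l) (i <ᵇ j) (length l ≡ᵇ k)

countᵇ-boundedDistinct : ∀ f n m j k → n ≤ f →
  countᵇ (boundedDistinct j k) (partitionsBounded f n m) ≡ distinctCount (+ n) (m ⊓ j) k
countᵇ-boundedDistinct f       zero    m j zero    _ = refl
countᵇ-boundedDistinct f       zero    m j (suc k) _ = sym ([]·-zero (suc k ≤ᵇ m ⊓ j))
countᵇ-boundedDistinct (suc f) (suc n) m j zero    (s≤s n≤f) = begin
  countᵇ (boundedDistinct j 0) (partitionsBounded (suc f) (suc n) m)
    ≡⟨ countᵇ-partitionsBounded (boundedDistinct j 0) f n m ⟩
  ∑[ i < suc n ] ([ i <ᵇ m ]· countᵇ (λ l → boundedDistinct j 0 (suc i ∷ l)) (partitionsBounded f (n ∸ i) (suc i)))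
    ≡⟨ ∑-zero (suc n) (λ i _ → trans (cong ([ i <ᵇ m ]·_) (nonempty i)) ([]·-zero (i <ᵇ m))) ⟩
  0
    ≡⟨ trans (box-no-parts 1 (m ⊓ j) (+ suc n - + 0)) (δ₀-≢ (suc n) 0 (λ ())) ⟨
  distinctCount (+ suc n) (m ⊓ j) 0 ∎
  where
  nonempty : ∀ i → countᵇ (λ l → boundedDistinct j 0 (suc i ∷ l)) (partitionsBounded f (n ∸ i) (suc i)) ≡ 0
  nonempty i = trans (countᵇ-cong L (λ l → ∧-zeroʳ _)) (countᵇ-false L)
    where L = partitionsBounded f (n ∸ i) (suc i)
countᵇ-boundedDistinct (suc f) (suc n) m j (suc k) (s≤s n≤f) = begin
  countᵇ (boundedDistinct j (suc k)) (partitionsBounded (suc f) (suc n) m)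
    ≡⟨ countᵇ-partitionsBounded (boundedDistinct j (suc k)) f n m ⟩
  ∑[ i < suc n ] ([ i <ᵇ m ]· countᵇ (λ l → boundedDistinct j (suc k) (suc i ∷ l)) (partitionsBounded f (n ∸ i) (suc i)))
    ≡⟨ ∑-cong (suc n) first-part ⟩
  ∑[ i < suc n ] ([ i <ᵇ m ⊓ j ]· H i)
    ≡⟨ ∑-[<ᵇ]· H (suc n) (m ⊓ j) ⟩
  ∑ (suc n ⊓ (m ⊓ j)) H
    ≡⟨ ∑-⊓ H (suc n) (m ⊓ j) too-large ⟩
  ∑ (m ⊓ j) H
    ≡⟨ distinctCount-largest (+ suc n) (m ⊓ j) k ⟩
  distinctCount (+ suc n) (m ⊓ j) (suc k) ∎
  where
  H : ℕ → ℕ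
  H i = distinctCount (+ suc n - + suc i) i k
  first-part : ∀ i → i < suc n →
    [ i <ᵇ m ]· countᵇ (λ l → boundedDistinct j (suc k) (suc i ∷ l)) (partitionsBounded f (n ∸ i) (suc i)) ≡ [ i <ᵇ m ⊓ j ]· H i
  first-part i (s≤s i≤n) = begin
    [ i <ᵇ m ]· countᵇ (λ l → boundedDistinct j (suc k) (suc i ∷ l)) L
      ≡⟨ cong ([ i <ᵇ m ]·_) (trans (countᵇ-cong L (boundedDistinct-∷ j k i)) (countᵇ-∧ˡ (i <ᵇ j) (boundedDistinct i k) L)) ⟩
    [ i <ᵇ m ]· [ i <ᵇ j ]· countᵇ (boundedDistinct i k) L
      ≡⟨ cong (λ x → [ i <ᵇ m ]· [ i <ᵇ j ]· x) (countᵇ-boundedDistinct f (n ∸ i) (suc i) i k (≤-trans (m∸n≤m n i) n≤f)) ⟩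
    [ i <ᵇ m ]· [ i <ᵇ j ]· distinctCount (+ (n ∸ i)) (suc i ⊓ i) k
      ≡⟨ cong₂ (λ N b → [ i <ᵇ m ]· [ i <ᵇ j ]· distinctCount N b k) (+[m∸n]≡[1+m]-[1+n] i≤n) (m≥n⇒m⊓n≡n (n≤1+n i)) ⟩
    [ i <ᵇ m ]· [ i <ᵇ j ]· H i
      ≡⟨ [<ᵇ]·-⊓ i m j (H i) ⟩
    [ i <ᵇ m ⊓ j ]· H i ∎
    where L = partitionsBounded f (n ∸ i) (suc i)
  too-large : ∀ i → suc n ≤ i → H i ≡ 0
  too-large i n<i = distinctCount-negative i k (s≤s n<i)

qSum : ℕ → ℕ
qSum n = ∑[ x < suc n ] parts[ 1 , x ] (+ n - + triangle x)

q≡qSum : ∀ n → q n ≡ qSum n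
q≡qSum zero    = refl
q≡qSum (suc n) = begin
  countᵇ distinctParts (partitionsBounded (suc n) (suc n) (suc n))
    ≡⟨ countᵇ-partitionsBounded distinctParts n n (suc n) ⟩
  ∑[ i < suc n ] ([ i <ᵇ suc n ]· countᵇ (λ l → distinctParts (suc i ∷ l)) (partitionsBounded n (n ∸ i) (suc i)))
    ≡⟨ ∑-cong (suc n) first-part ⟩
  ∑[ i < suc n ] ∑[ k < suc n ] distinctCount (+ suc n - + suc i) i k
    ≡⟨ ∑-comm (λ i k → distinctCount (+ suc n - + suc i) i k) (suc n) (suc n) ⟩
  ∑[ k < suc n ] ∑[ i < suc n ] distinctCount (+ suc n - + suc i) i k
    ≡⟨ ∑-cong (suc n) (λ k _ → trans (distinctCount-largest (+ suc n) (suc n) k) (distinctCount≡parts (suc n) (suc k))) ⟩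
  ∑[ k < suc n ] parts[ 1 , suc k ] (+ suc n - + triangle (suc k))
    ≡⟨ ∑-head (λ x → parts[ 1 , x ] (+ suc n - + triangle x)) (suc n) ⟨
  qSum (suc n) ∎
  where
  first-part : ∀ i → i < suc n →
    [ i <ᵇ suc n ]· countᵇ (λ l → distinctParts (suc i ∷ l)) (partitionsBounded n (n ∸ i) (suc i))
      ≡ ∑[ k < suc n ] distinctCount (+ suc n - + suc i) i k
  first-part i (s≤s i≤n) = begin
    [ i <ᵇ suc n ]· countᵇ (λ l → distinctParts (suc i ∷ l)) L
      ≡⟨ cong₂ [_]·_ (≤⇒≤ᵇ≡true (s≤s i≤n)) (countᵇ-cong L (distinctParts-∷ i)) ⟩
    countᵇ (λ l → distinctParts l ∧ headAtMost i l) L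
      ≡⟨ countᵇ-by-length (λ l → distinctParts l ∧ headAtMost i l) L (suc n) ⟩
    ∑[ k < suc n ] countᵇ (boundedDistinct i k) L + countᵇ (λ l → (distinctParts l ∧ headAtMost i l) ∧ (suc n ≤ᵇ length l)) L
      ≡⟨ cong (_+_ (∑[ k < suc n ] countᵇ (boundedDistinct i k) L))
              (countᵇ-too-long (λ l → distinctParts l ∧ headAtMost i l) n (n ∸ i) (suc i) (suc n) (m∸n≤m n i) (s≤s (m∸n≤m n i))) ⟩
    ∑[ k < suc n ] countᵇ (boundedDistinct i k) L + 0
      ≡⟨ +-identityʳ _ ⟩
    ∑[ k < suc n ] countᵇ (boundedDistinct i k) L
      ≡⟨ ∑-cong (suc n) (λ k _ → trans (countᵇ-boundedDistinct n (n ∸ i) (suc i) i k (m∸n≤m n i))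
                                       (cong₂ (λ N b → distinctCount N b k) (+[m∸n]≡[1+m]-[1+n] i≤n) (m≥n⇒m⊓n≡n (n≤1+n i)))) ⟩
    ∑[ k < suc n ] distinctCount (+ suc n - + suc i) i k ∎
    where L = partitionsBounded n (n ∸ i) (suc i)


-- The special partitions

startsWith123 : List ℕ → Bool
startsWith123 (x ∷ y ∷ z ∷ _) = (x ≡ᵇ 1) ∧ ((y ≡ᵇ 2) ∧ (z ≡ᵇ 3))
startsWith123 _               = false

-- endsIn321 matches on reverse l through a with-function, whose clauses are replayed here.
endsIn321-reverse : ∀ l → endsIn321 l ≡ startsWith123 (reverse l)
endsIn321-reverse l with reverse l
... | []                                  = refl
... | 0 ∷ []                              = refl
... | 1 ∷ []                              = refl
... | suc (suc _) ∷ []                    = refl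
... | 0 ∷ _ ∷ []                          = refl
... | suc (suc _) ∷ _ ∷ []                = refl
... | 1 ∷ 0 ∷ []                          = refl
... | 1 ∷ 1 ∷ []                          = refl
... | 1 ∷ 2 ∷ []                          = refl
... | 1 ∷ suc (suc (suc _)) ∷ []          = refl
... | 0 ∷ _ ∷ _ ∷ _                       = refl
... | suc (suc _) ∷ _ ∷ _ ∷ _             = refl
... | 1 ∷ 0 ∷ _ ∷ _                       = refl
... | 1 ∷ 1 ∷ _ ∷ _                       = refl
... | 1 ∷ suc (suc (suc _)) ∷ _ ∷ _       = refl
... | 1 ∷ 2 ∷ 0 ∷ _                       = refl
... | 1 ∷ 2 ∷ 1 ∷ _                       = refl
... | 1 ∷ 2 ∷ 2 ∷ _                       = refl
... | 1 ∷ 2 ∷ 3 ∷ _                       = refl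
... | 1 ∷ 2 ∷ suc (suc (suc (suc _))) ∷ _ = refl

endsIn321-∷ : ∀ a b c d l → endsIn321 (a ∷ b ∷ c ∷ d ∷ l) ≡ endsIn321 (b ∷ c ∷ d ∷ l)
endsIn321-∷ a b c d l = begin
  endsIn321 (a ∷ L)                ≡⟨ endsIn321-reverse (a ∷ L) ⟩
  startsWith123 (reverse (a ∷ L))  ≡⟨ cong startsWith123 (unfold-reverse a L) ⟩
  startsWith123 (reverse L ∷ʳ a)   ≡⟨ prefix (reverse L) (subst (3 ≤_) (sym (length-reverse L)) (s≤s (s≤s (s≤s z≤n)))) ⟩
  startsWith123 (reverse L)        ≡⟨ endsIn321-reverse L ⟨
  endsIn321 L                      ∎
  where
  L = b ∷ c ∷ d ∷ l
  prefix : ∀ xs → 3 ≤ length xs → startsWith123 (xs ∷ʳ a) ≡ startsWith123 xs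
  prefix (x ∷ y ∷ z ∷ r) _                   = refl
  prefix (x ∷ [])        (s≤s ())
  prefix (x ∷ y ∷ [])    (s≤s (s≤s ()))

step : ℕ → ℕ → Bool
step y z = (y ≡ᵇ z) ∨ (y ≡ᵇ suc z)

stairTail : ℕ → List ℕ → Bool
stairTail y []              = false
stairTail y (z ∷ [])        = false
stairTail y (z ∷ w ∷ [])    = (w ≡ᵇ 1) ∧ ((z ≡ᵇ 2) ∧ (y ≡ᵇ 3))
stairTail y (z ∷ w ∷ v ∷ l) = step y z ∧ stairTail z (w ∷ v ∷ l)

consecStep∧321≡321 : ∀ y z w → let e = (w ≡ᵇ 1) ∧ ((z ≡ᵇ 2) ∧ (y ≡ᵇ 3)) in (consecStep (y ∷ z ∷ w ∷ []) ∧ e) ≡ e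
consecStep∧321≡321 y z w with y ≟ 3 | z ≟ 2 | w ≟ 1
... | yes refl | yes refl | yes refl = refl
... | no y≢3   | _        | _        = ∧-zeroʳ′ (consecStep (y ∷ z ∷ w ∷ [])) not321
  where
  not321 : ((w ≡ᵇ 1) ∧ ((z ≡ᵇ 2) ∧ (y ≡ᵇ 3))) ≡ false
  not321 rewrite ≢⇒≡ᵇ≡false y≢3 | ∧-zeroʳ (z ≡ᵇ 2) = ∧-zeroʳ (w ≡ᵇ 1)
... | yes refl | no z≢2   | _        = ∧-zeroʳ′ (consecStep (3 ∷ z ∷ w ∷ [])) not321
  where
  not321 : ((w ≡ᵇ 1) ∧ ((z ≡ᵇ 2) ∧ true)) ≡ false
  not321 rewrite ≢⇒≡ᵇ≡false z≢2 = ∧-zeroʳ (w ≡ᵇ 1)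
... | yes refl | yes refl | no w≢1   = ∧-zeroʳ′ (consecStep (3 ∷ 2 ∷ w ∷ [])) (cong (_∧ true) (≢⇒≡ᵇ≡false w≢1))

consecStep∧endsIn321≡stairTail : ∀ y l → (consecStep (y ∷ l) ∧ endsIn321 (y ∷ l)) ≡ stairTail y l
consecStep∧endsIn321≡stairTail y []              = endsIn321-reverse (y ∷ [])
consecStep∧endsIn321≡stairTail y (z ∷ [])        = trans (cong ((step y z ∧ true) ∧_) (endsIn321-reverse (y ∷ z ∷ []))) (∧-zeroʳ _)
consecStep∧endsIn321≡stairTail y (z ∷ w ∷ [])    =
  trans (cong (consecStep (y ∷ z ∷ w ∷ []) ∧_) (endsIn321-reverse (y ∷ z ∷ w ∷ []))) (consecStep∧321≡321 y z w)
consecStep∧endsIn321≡stairTail y (z ∷ w ∷ v ∷ l) =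
  trans (cong ((step y z ∧ consecStep (z ∷ w ∷ v ∷ l)) ∧_) (endsIn321-∷ y z w v l))
        (trans (∧-assoc (step y z) _ _) (cong (step y z ∧_) (consecStep∧endsIn321≡stairTail z (w ∷ v ∷ l))))

isOne : List ℕ → Bool
isOne (x ∷ []) = x ≡ᵇ 1
isOne _        = false

stairTail-∷ : ∀ y z l → stairTail y (z ∷ l) ≡ (step y z ∧ (stairTail z l ∨ (((y ≡ᵇ 3) ∧ (z ≡ᵇ 2)) ∧ isOne l)))
stairTail-∷ y z []              = sym (trans (cong (λ b → step y z ∧ (false ∨ b)) (∧-zeroʳ ((y ≡ᵇ 3) ∧ (z ≡ᵇ 2)))) (∧-zeroʳ (step y z)))
stairTail-∷ y z (w ∷ [])        with y ≟ 3 | z ≟ 2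
... | yes refl | yes refl = ∧-identityʳ (w ≡ᵇ 1)
... | no y≢3   | _        rewrite ≢⇒≡ᵇ≡false y≢3 | ∧-zeroʳ (z ≡ᵇ 2) | ∧-zeroʳ (w ≡ᵇ 1) = sym (∧-zeroʳ (step y z))
... | yes refl | no z≢2   rewrite ≢⇒≡ᵇ≡false z≢2 | ∧-zeroʳ (w ≡ᵇ 1) = sym (∧-zeroʳ (step 3 z))
stairTail-∷ y z (w ∷ v ∷ l)     rewrite ∧-zeroʳ ((y ≡ᵇ 3) ∧ (z ≡ᵇ 2)) | ∨-identityʳ (stairTail z (w ∷ v ∷ l)) = refl

stairTail∧isOne≡false : ∀ z b l → (stairTail z l ∧ (b ∧ isOne l)) ≡ false
stairTail∧isOne≡false z b []          = refl
stairTail∧isOne≡false z b (w ∷ [])    = refl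
stairTail∧isOne≡false z b (w ∷ v ∷ l) = trans (cong (stairTail z (w ∷ v ∷ l) ∧_) (∧-zeroʳ b)) (∧-zeroʳ _)

special-∷∷ : ∀ x z l → special (x ∷ z ∷ l) ≡ ((x ≡ᵇ z) ∧ stairTail z l)
special-∷∷ x z []          = sym (∧-zeroʳ (x ≡ᵇ z))
special-∷∷ x z (w ∷ [])    = sym (∧-zeroʳ (x ≡ᵇ z))
special-∷∷ x z (w ∷ v ∷ l)
  rewrite endsIn321-∷ x z w v l | sym (consecStep∧endsIn321≡stairTail z (w ∷ v ∷ l)) with x ≡ᵇ z
... | true  = refl
... | false = ∧-zeroʳ _

isOne-∷ : ∀ i l → isOne (suc i ∷ l) ≡ ((i ≡ᵇ 0) ∧ null l)
isOne-∷ i []      = sym (∧-identityʳ (i ≡ᵇ 0))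
isOne-∷ i (x ∷ l) = sym (∧-zeroʳ (i ≡ᵇ 0))

countᵇ-null : ∀ f n m → n ≤ f → countᵇ null (partitionsBounded f n m) ≡ δ₀ (+ n)
countᵇ-null f       zero    m _ = refl
countᵇ-null (suc f) (suc n) m _ = trans (countᵇ-partitionsBounded null f n m)
  (∑-zero (suc n) (λ i _ → trans (cong ([ i <ᵇ m ]·_) (countᵇ-false (partitionsBounded f (n ∸ i) (suc i)))) ([]·-zero (i <ᵇ m))))

countᵇ-isOne : ∀ f n m → n ≤ f → 1 ≤ m → countᵇ isOne (partitionsBounded f n m) ≡ δ₀ (+ n - + 1)
countᵇ-isOne f       zero    m       _         _ = refl
countᵇ-isOne (suc f) (suc n) (suc m) (s≤s n≤f) _ = begin
  countᵇ isOne (partitionsBounded (suc f) (suc n) (suc m)) ≡⟨ countᵇ-partitionsBounded isOne f n (suc m) ⟩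
  ∑ (suc n) G                                              ≡⟨ ∑-head G n ⟩
  G 0 + ∑[ i < n ] G (suc i)                               ≡⟨ cong₂ _+_ single (∑-zero n (λ i _ → longer i)) ⟩
  δ₀ (+ n) + 0                                             ≡⟨ +-identityʳ _ ⟩
  δ₀ (+ n)                                                 ≡⟨ cong δ₀ (+[m∸n]≡[1+m]-[1+n] z≤n) ⟩
  δ₀ (+ suc n - + 1)                                       ∎
  where
  G : ℕ → ℕ
  G i = [ i <ᵇ suc m ]· countᵇ (λ l → isOne (suc i ∷ l)) (partitionsBounded f (n ∸ i) (suc i))
  rest : ∀ i → G i ≡ [ i <ᵇ suc m ]· [ i ≡ᵇ 0 ]· countᵇ null (partitionsBounded f (n ∸ i) (suc i))
  rest i = cong ([ i <ᵇ suc m ]·_) (trans (countᵇ-cong (partitionsBounded f (n ∸ i) (suc i)) (isOne-∷ i))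
                                          (countᵇ-∧ˡ (i ≡ᵇ 0) null (partitionsBounded f (n ∸ i) (suc i))))
  single : G 0 ≡ δ₀ (+ n)
  single = trans (rest 0) (countᵇ-null f n 1 n≤f)
  longer : ∀ i → G (suc i) ≡ 0
  longer i = trans (rest (suc i)) ([]·-zero (suc i <ᵇ suc m))

-- After a part y ≥ 3, a stair tail consists of y − 1, …, 2, 1 once each together with
-- a partition into parts in [3, y].
tailCount : ℤ → ℕ → ℕ
tailCount N zero    = 0
tailCount N (suc y) = [ 3 ≤ᵇ suc y ]· parts[ 3 , suc y ] (N - + triangle y)

tailCount-negative : ∀ {a b} y → a < b → tailCount (+ a - + b) y ≡ 0
tailCount-negative         zero    a<b = refl
tailCount-negative {a} {b} (suc y) a<b = begin
  [ 3 ≤ᵇ suc y ]· parts[ 3 , suc y ] (+ a - + b - + triangle y)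
    ≡⟨ cong (λ N → [ 3 ≤ᵇ suc y ]· parts[ 3 , suc y ] N) (-[a+b]≡-a-b (+ a) (+ b) (+ triangle y)) ⟨
  [ 3 ≤ᵇ suc y ]· parts[ 3 , suc y ] (+ a - + (b + triangle y))
    ≡⟨ cong ([ 3 ≤ᵇ suc y ]·_) (box-of-negative 3 ℤ.∣ + a - + (b + triangle y) ∣ (suc y) (<-≤-trans a<b (m≤m+n b (triangle y)))) ⟩
  [ 3 ≤ᵇ suc y ]· 0
    ≡⟨ []·-zero (3 ≤ᵇ suc y) ⟩
  0 ∎

tailCount-zero : ∀ y → tailCount (+ 0) y ≡ 0
tailCount-zero 0                   = refl
tailCount-zero 1                   = refl
tailCount-zero 2                   = refl
tailCount-zero (suc (suc (suc y))) = box-of-negative 3 ℤ.∣ + 0 - + triangle (suc (suc y)) ∣ (suc (suc (suc y))) {0} {triangle (suc (suc y))} (s≤s z≤n)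

-- Stair tails after y of weight N whose first part is 1 + i, before imposing step y (1 + i).
tailFrom : ℕ → ℤ → ℕ → ℕ
tailFrom y N i = tailCount (N - + suc i) (suc i) + [ (y ≡ᵇ 3) ∧ (i ≡ᵇ 1) ]· δ₀ (N - + suc i - + 1)

tailFrom-too-large : ∀ y {n i} → n ≤ i → tailFrom y (+ n) i ≡ 0
tailFrom-too-large y {n} {i} n≤i = begin
  tailCount (+ n - + suc i) (suc i) + [ X ]· δ₀ (+ n - + suc i - + 1)
    ≡⟨ cong₂ _+_ (tailCount-negative (suc i) (s≤s n≤i)) (cong ([ X ]·_) beyond) ⟩
  [ X ]· 0
    ≡⟨ []·-zero X ⟩
  0 ∎
  where
  X = (y ≡ᵇ 3) ∧ (i ≡ᵇ 1)
  beyond : δ₀ (+ n - + suc i - + 1) ≡ 0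
  beyond = trans (cong δ₀ (sym (-[a+b]≡-a-b (+ n) (+ suc i) (+ 1))))
                 (δ₀-≢ n (suc i + 1) (<⇒≢ (<-≤-trans (s≤s n≤i) (m≤m+n (suc i) 1))))

tailFrom-last-two : ∀ y N → tailFrom (suc (suc y)) N y + tailFrom (suc (suc y)) N (suc y) ≡ tailCount N (suc (suc y))
tailFrom-last-two zero                N = refl
tailFrom-last-two (suc zero)          N = begin
  δ₀ (N - + 2 - + 1) + (parts[ 3 , 3 ] (N - + 3 - + 3) + 0)
    ≡⟨ cong₂ _+_ (trans (cong δ₀ (sym (-[a+b]≡-a-b N (+ 2) (+ 1)))) (sym (parts-below 3 2 (N - + 3) (n<1+n 2)))) (+-identityʳ _) ⟩
  parts[ 3 , 2 ] (N - + 3) + parts[ 3 , 3 ] (N - + 3 - + 3)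
    ≡⟨ parts-step 3 2 (N - + 3) ≤-refl ⟨
  parts[ 3 , 3 ] (N - + 3) ∎
tailFrom-last-two (suc (suc y))       N = begin
  (tailCount (N - + suc x) (suc x) + 0) + (tailCount (N - + suc (suc x)) (suc (suc x)) + 0)
    ≡⟨ cong₂ _+_ (+-identityʳ (tailCount (N - + suc x) (suc x))) (+-identityʳ (tailCount (N - + suc (suc x)) (suc (suc x)))) ⟩
  parts[ 3 , suc x ] (N - + suc x - + triangle x) + parts[ 3 , suc (suc x) ] (N - + suc (suc x) - + triangle (suc x))
    ≡⟨ cong₂ _+_ (cong parts[ 3 , suc x ]_ (sym (-[a+b]≡-a-b N (+ suc x) (+ triangle x))))
                 (cong parts[ 3 , suc (suc x) ]_ (-a-b≡-b-a N (+ suc (suc x)) (+ triangle (suc x)))) ⟩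
  parts[ 3 , suc x ] (N - + triangle (suc x)) + parts[ 3 , suc (suc x) ] (N - + triangle (suc x) - + suc (suc x))
    ≡⟨ parts-step 3 (suc x) (N - + triangle (suc x)) (s≤s (s≤s (s≤s z≤n))) ⟨
  parts[ 3 , suc (suc x) ] (N - + triangle (suc x)) ∎
  where x = suc (suc y)

tailCount-by-first : ∀ N y → ∑[ i < y ] ([ step y (suc i) ]· tailFrom y N i) ≡ tailCount N y
tailCount-by-first N zero          = refl
tailCount-by-first N (suc zero)    = refl
tailCount-by-first N (suc (suc y)) = begin
  (∑ y G + G y) + G (suc y)
    ≡⟨ cong (λ s → (s + G y) + G (suc y)) (∑-zero y (λ i i<y → cong ([_]· tailFrom (suc (suc y)) N i) (no-step i<y))) ⟩
  G y + G (suc y)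
    ≡⟨ cong₂ (λ a b → [ a ]· tailFrom (suc (suc y)) N y + [ b ]· tailFrom (suc (suc y)) N (suc y)) step-down step-equal ⟩
  tailFrom (suc (suc y)) N y + tailFrom (suc (suc y)) N (suc y)
    ≡⟨ tailFrom-last-two y N ⟩
  tailCount N (suc (suc y)) ∎
  where
  G : ℕ → ℕ
  G i = [ step (suc (suc y)) (suc i) ]· tailFrom (suc (suc y)) N i
  no-step : ∀ {i} → i < y → step (suc (suc y)) (suc i) ≡ false
  no-step {i} i<y rewrite ≢⇒≡ᵇ≡false {suc y} {i} (≢-sym (<⇒≢ (<-trans i<y (n<1+n y)))) | ≢⇒≡ᵇ≡false {y} {i} (≢-sym (<⇒≢ i<y)) = refl
  step-down : step (suc (suc y)) (suc y) ≡ true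
  step-down rewrite ≡ᵇ-refl y = ∨-zeroʳ (suc y ≡ᵇ y)
  step-equal : step (suc (suc y)) (suc (suc y)) ≡ true
  step-equal rewrite ≡ᵇ-refl y = refl

countᵇ-stairTail : ∀ f n y → n ≤ f → countᵇ (stairTail y) (partitionsBounded f n y) ≡ tailCount (+ n) y
countᵇ-stairTail f       zero    y _         = sym (tailCount-zero y)
countᵇ-stairTail (suc f) (suc n) y (s≤s n≤f) = begin
  countᵇ (stairTail y) (partitionsBounded (suc f) (suc n) y)
    ≡⟨ countᵇ-partitionsBounded (stairTail y) f n y ⟩
  ∑[ i < suc n ] ([ i <ᵇ y ]· countᵇ (λ l → stairTail y (suc i ∷ l)) (partitionsBounded f (n ∸ i) (suc i)))
    ≡⟨ ∑-cong (suc n) (λ i i≤n → cong ([ i <ᵇ y ]·_) (first-part i i≤n)) ⟩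
  ∑[ i < suc n ] ([ i <ᵇ y ]· G i)
    ≡⟨ ∑-[<ᵇ]· G (suc n) y ⟩
  ∑ (suc n ⊓ y) G
    ≡⟨ ∑-⊓ G (suc n) y too-large ⟩
  ∑ y G
    ≡⟨ tailCount-by-first (+ suc n) y ⟩
  tailCount (+ suc n) y ∎
  where
  G : ℕ → ℕ
  G i = [ step y (suc i) ]· tailFrom y (+ suc n) i
  first-part : ∀ i → i < suc n → countᵇ (λ l → stairTail y (suc i ∷ l)) (partitionsBounded f (n ∸ i) (suc i)) ≡ G i
  first-part i (s≤s i≤n) = begin
    countᵇ (λ l → stairTail y (suc i ∷ l)) L
      ≡⟨ countᵇ-cong L (stairTail-∷ y (suc i)) ⟩
    countᵇ (λ l → step y (suc i) ∧ (stairTail (suc i) l ∨ (X ∧ isOne l))) L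
      ≡⟨ countᵇ-∧ˡ (step y (suc i)) (λ l → stairTail (suc i) l ∨ (X ∧ isOne l)) L ⟩
    [ step y (suc i) ]· countᵇ (λ l → stairTail (suc i) l ∨ (X ∧ isOne l)) L
      ≡⟨ cong ([ step y (suc i) ]·_) (countᵇ-∨ (stairTail (suc i)) (λ l → X ∧ isOne l) L (stairTail∧isOne≡false (suc i) X)) ⟩
    [ step y (suc i) ]· (countᵇ (stairTail (suc i)) L + countᵇ (λ l → X ∧ isOne l) L)
      ≡⟨ cong (λ c → [ step y (suc i) ]· (countᵇ (stairTail (suc i)) L + c)) (countᵇ-∧ˡ X isOne L) ⟩
    [ step y (suc i) ]· (countᵇ (stairTail (suc i)) L + [ X ]· countᵇ isOne L)
      ≡⟨ cong₂ (λ a b → [ step y (suc i) ]· (a + [ X ]· b)) (countᵇ-stairTail f (n ∸ i) (suc i) n∸i≤f)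
                                                           (countᵇ-isOne f (n ∸ i) (suc i) n∸i≤f (s≤s z≤n)) ⟩
    [ step y (suc i) ]· (tailCount (+ (n ∸ i)) (suc i) + [ X ]· δ₀ (+ (n ∸ i) - + 1))
      ≡⟨ cong (λ N → [ step y (suc i) ]· (tailCount N (suc i) + [ X ]· δ₀ (N - + 1))) (+[m∸n]≡[1+m]-[1+n] i≤n) ⟩
    G i ∎
    where
    L = partitionsBounded f (n ∸ i) (suc i)
    X = (y ≡ᵇ 3) ∧ (i ≡ᵇ 1)
    n∸i≤f = ≤-trans (m∸n≤m n i) n≤f
  too-large : ∀ i → suc n ≤ i → G i ≡ 0
  too-large i n<i = trans (cong ([ step y (suc i) ]·_) (tailFrom-too-large y n<i)) ([]·-zero (step y (suc i)))

countᵇ-special-top : ∀ f N i → N ≤ f →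
  countᵇ (λ l → special (suc i ∷ l)) (partitionsBounded f N (suc i)) ≡ tailCount (+ N - + suc i) (suc i)
countᵇ-special-top f       zero    i _         = sym (tailCount-negative (suc i) (s≤s z≤n))
countᵇ-special-top (suc f) (suc N) i (s≤s N≤f) = begin
  countᵇ (λ l → special (suc i ∷ l)) (partitionsBounded (suc f) (suc N) (suc i))
    ≡⟨ countᵇ-partitionsBounded (λ l → special (suc i ∷ l)) f N (suc i) ⟩
  ∑[ j < suc N ] ([ j <ᵇ suc i ]· countᵇ (λ l → special (suc i ∷ suc j ∷ l)) (partitionsBounded f (N ∸ j) (suc j)))
    ≡⟨ ∑-cong (suc N) second-part ⟩
  ∑[ j < suc N ] ([ i ≡ᵇ j ]· H j)
    ≡⟨ ∑-[≡ᵇ]· H i (suc N) ⟩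
  [ i <ᵇ suc N ]· H i
    ≡⟨ in-range ⟩
  tailCount (+ suc N - + suc i) (suc i) ∎
  where
  H : ℕ → ℕ
  H j = tailCount (+ suc N - + suc j) (suc j)
  only-equal : ∀ j x → [ j <ᵇ suc i ]· [ i ≡ᵇ j ]· x ≡ [ i ≡ᵇ j ]· x
  only-equal j x with i ≟ j
  ... | yes refl rewrite ≡ᵇ-refl i | ≤⇒≤ᵇ≡true (n<1+n i) = refl
  ... | no  i≢j  rewrite ≢⇒≡ᵇ≡false i≢j = []·-zero (j <ᵇ suc i)
  second-part : ∀ j → j < suc N →
    [ j <ᵇ suc i ]· countᵇ (λ l → special (suc i ∷ suc j ∷ l)) (partitionsBounded f (N ∸ j) (suc j)) ≡ [ i ≡ᵇ j ]· H j
  second-part j (s≤s j≤N) = begin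
    [ j <ᵇ suc i ]· countᵇ (λ l → special (suc i ∷ suc j ∷ l)) L
      ≡⟨ cong ([ j <ᵇ suc i ]·_) (trans (countᵇ-cong L (special-∷∷ (suc i) (suc j))) (countᵇ-∧ˡ (i ≡ᵇ j) (stairTail (suc j)) L)) ⟩
    [ j <ᵇ suc i ]· [ i ≡ᵇ j ]· countᵇ (stairTail (suc j)) L
      ≡⟨ only-equal j (countᵇ (stairTail (suc j)) L) ⟩
    [ i ≡ᵇ j ]· countᵇ (stairTail (suc j)) L
      ≡⟨ cong ([ i ≡ᵇ j ]·_) (countᵇ-stairTail f (N ∸ j) (suc j) (≤-trans (m∸n≤m N j) N≤f)) ⟩
    [ i ≡ᵇ j ]· tailCount (+ (N ∸ j)) (suc j)
      ≡⟨ cong (λ M → [ i ≡ᵇ j ]· tailCount M (suc j)) (+[m∸n]≡[1+m]-[1+n] j≤N) ⟩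
    [ i ≡ᵇ j ]· H j ∎
    where L = partitionsBounded f (N ∸ j) (suc j)
  in-range : [ i <ᵇ suc N ]· H i ≡ H i
  in-range with i <? suc N
  ... | yes i<N rewrite ≤⇒≤ᵇ≡true i<N = refl
  ... | no  i≮N rewrite >⇒≤ᵇ≡false {suc i} {suc N} (≰⇒> i≮N) = sym (tailCount-negative (suc i) (≰⇒> i≮N))

specialSum : ℕ → ℕ
specialSum n = ∑[ x < suc n ] tailCount (+ n - + x - + x) x

specialCount≡specialSum : ∀ n → specialCount n ≡ specialSum n
specialCount≡specialSum zero    = refl
specialCount≡specialSum (suc n) = begin
  countᵇ special (partitionsBounded (suc n) (suc n) (suc n))
    ≡⟨ countᵇ-partitionsBounded special n n (suc n) ⟩
  ∑[ i < suc n ] ([ i <ᵇ suc n ]· countᵇ (λ l → special (suc i ∷ l)) (partitionsBounded n (n ∸ i) (suc i)))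
    ≡⟨ ∑-cong (suc n) top-part ⟩
  ∑[ i < suc n ] tailCount (+ suc n - + suc i - + suc i) (suc i)
    ≡⟨ ∑-head (λ x → tailCount (+ suc n - + x - + x) x) (suc n) ⟨
  specialSum (suc n) ∎
  where
  top-part : ∀ i → i < suc n →
    [ i <ᵇ suc n ]· countᵇ (λ l → special (suc i ∷ l)) (partitionsBounded n (n ∸ i) (suc i))
      ≡ tailCount (+ suc n - + suc i - + suc i) (suc i)
  top-part i (s≤s i≤n) rewrite ≤⇒≤ᵇ≡true (s≤s i≤n) =
    trans (countᵇ-special-top n (n ∸ i) i (m∸n≤m n i)) (cong (λ M → tailCount (M - + suc i) (suc i)) (+[m∸n]≡[1+m]-[1+n] i≤n))


-- The second difference of q

ΔqSum : ℕ → ℕ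
ΔqSum n = ∑[ x < suc n ] parts[ 2 , x ] (+ n - + triangle x)

qSum-step : ∀ n → qSum (suc (suc n)) ≡ ΔqSum (suc (suc n)) + qSum (suc n)
qSum-step n = begin
  ∑[ x < suc N ] parts[ 1 , x ] (+ N - + triangle x)
    ≡⟨ ∑-cong (suc N) split ⟩
  ∑[ x < suc N ] (parts[ 2 , x ] (+ N - + triangle x) + parts[ 1 , x ] (+ suc n - + triangle x))
    ≡⟨ ∑-distrib-+ (λ x → parts[ 2 , x ] (+ N - + triangle x)) (λ x → parts[ 1 , x ] (+ suc n - + triangle x)) (suc N) ⟩
  ΔqSum N + (qSum (suc n) + parts[ 1 , N ] (+ suc n - + triangle N))
    ≡⟨ cong (λ c → ΔqSum N + (qSum (suc n) + c)) (box-of-negative 1 _ N (<-≤-trans (n<1+n (suc n)) (n≤triangle N))) ⟩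
  ΔqSum N + (qSum (suc n) + 0)
    ≡⟨ cong (_+_ (ΔqSum N)) (+-identityʳ (qSum (suc n))) ⟩
  ΔqSum N + qSum (suc n) ∎
  where
  N = suc (suc n)
  split : ∀ x → x < suc N → parts[ 1 , x ] (+ N - + triangle x) ≡ parts[ 2 , x ] (+ N - + triangle x) + parts[ 1 , x ] (+ suc n - + triangle x)
  split zero    _
    rewrite parts-below 1 0 (+ N - + 0) (s≤s z≤n) | parts-below 2 0 (+ N - + 0) (s≤s z≤n)
          | parts-below 1 0 (+ suc n - + 0) (s≤s z≤n) | δ₀-≢ (suc n) 0 (λ ()) = refl
  split (suc x) _ = trans (parts-raise-min 0 (suc x) (+ N - + triangle (suc x)) (s≤s z≤n))
                          (cong (λ M → parts[ 2 , suc x ] (+ N - + triangle (suc x)) + parts[ 1 , suc x ] M) (shift (+ suc n) (+ triangle (suc x))))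
    where
    shift : ∀ (n T : ℤ) → (+ 1 ℤ.+ n) - T - + 1 ≡ n - T
    shift = solve-∀

-- a, b and σ are the summands of ΔqSum (1 + p), ΔqSum p and specialSum (1 + p). Splitting a and b
-- by parts-step and parts-raise-min produces pieces u and v that cancel between neighbouring x.
module Telescope (p : ℕ) (5≤p : 5 ≤ p) where

  a b σ u v : ℕ → ℕ
  a x       = parts[ 2 , x ] (+ suc p - + triangle x)
  b x       = parts[ 2 , x ] (+ p - + triangle x)
  σ x       = tailCount (+ suc p - + x - + x) x
  u x       = parts[ 2 , x ] (+ p - + triangle x - + x)
  v zero    = 0
  v (suc x) = parts[ 2 , x ] (+ p - + triangle (suc x))

  b-split : ∀ x → 1 ≤ x → b (suc x) ≡ v (suc x) + u (suc x)
  b-split x 1≤x = parts-step 2 x (+ p - + triangle (suc x)) (s≤s 1≤x)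

  a-split : ∀ x → 2 ≤ x → a (suc x) ≡ u x + (σ (suc x) + v (suc (suc x)))
  a-split x 2≤x = begin
    a (suc x)
      ≡⟨ parts-step 2 x M (m≤n⇒m≤1+n 2≤x) ⟩
    parts[ 2 , x ] M + parts[ 2 , suc x ] (M - + suc x)
      ≡⟨ cong₂ _+_ (cong parts[ 2 , x ]_ (drop-top (+ p) (+ x) (+ triangle x)))
                   (parts-raise-min 1 (suc x) (M - + suc x) (m≤n⇒m≤1+n 2≤x)) ⟩
    u x + (parts[ 3 , suc x ] (M - + suc x) + parts[ 2 , suc x ] (M - + suc x - + 2))
      ≡⟨ cong (_+_ (u x)) (cong₂ _+_ (sym σ-form) (cong parts[ 2 , suc x ]_ (drop-two (+ p) (+ x) (+ triangle x)))) ⟩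
    u x + (σ (suc x) + v (suc (suc x))) ∎
    where
    M = + suc p - + triangle (suc x)
    drop-top : ∀ (p x T : ℤ) → (+ 1 ℤ.+ p) - ((+ 1 ℤ.+ x) ℤ.+ T) ≡ p - T - x
    drop-top = solve-∀
    drop-two : ∀ (p x T : ℤ) → (+ 1 ℤ.+ p) - ((+ 1 ℤ.+ x) ℤ.+ T) - (+ 1 ℤ.+ x) - + 2 ≡ p - ((+ 2 ℤ.+ x) ℤ.+ ((+ 1 ℤ.+ x) ℤ.+ T))
    drop-two = solve-∀
    twice : ∀ (p x T : ℤ) → (+ 1 ℤ.+ p) - (+ 1 ℤ.+ x) - (+ 1 ℤ.+ x) - T ≡ (+ 1 ℤ.+ p) - ((+ 1 ℤ.+ x) ℤ.+ T) - (+ 1 ℤ.+ x)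
    twice = solve-∀
    σ-form : σ (suc x) ≡ parts[ 3 , suc x ] (M - + suc x)
    σ-form rewrite ≤⇒≤ᵇ≡true {3} {suc x} (s≤s 2≤x) = cong parts[ 3 , suc x ]_ (twice (+ p) (+ x) (+ triangle x))

  a-small : a 0 + a 1 ≡ 0
  a-small = cong₂ _+_ (trans (parts-below 2 0 (+ suc p - + 0) (s≤s z≤n)) (δ₀-≢ (suc p) 0 (λ ())))
                      (trans (parts-below 2 1 (+ suc p - + 1) (s≤s (s≤s z≤n))) (δ₀-≢ (suc p) 1 (>⇒≢ (s≤s (≤-trans (s≤s z≤n) 5≤p)))))

  b-small : b 0 + b 1 ≡ 0
  b-small = cong₂ _+_ (trans (parts-below 2 0 (+ p - + 0) (s≤s z≤n)) (δ₀-≢ p 0 (>⇒≢ (≤-trans (s≤s z≤n) 5≤p))))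
                      (trans (parts-below 2 1 (+ p - + 1) (s≤s (s≤s z≤n))) (δ₀-≢ p 1 (>⇒≢ (≤-trans (s≤s (s≤s z≤n)) 5≤p))))

  a-two : a 2 ≡ v 3
  a-two = begin
    parts[ 2 , 2 ] (+ suc p - + 3)
      ≡⟨ parts-step 2 1 (+ suc p - + 3) ≤-refl ⟩
    parts[ 2 , 1 ] (+ suc p - + 3) + parts[ 2 , 2 ] (+ suc p - + 3 - + 2)
      ≡⟨ cong₂ _+_ (trans (parts-below 2 1 (+ suc p - + 3) ≤-refl) (δ₀-≢ (suc p) 3 (>⇒≢ (≤-trans (s≤s (s≤s (s≤s (s≤s z≤n)))) (m≤n⇒m≤1+n 5≤p)))))
                   (parts-step 2 1 (+ suc p - + 3 - + 2) ≤-refl) ⟩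
    0 + (parts[ 2 , 1 ] (+ suc p - + 3 - + 2) + parts[ 2 , 2 ] (+ suc p - + 3 - + 2 - + 2))
      ≡⟨ cong (_+ parts[ 2 , 2 ] (+ suc p - + 3 - + 2 - + 2))
              (trans (parts-below 2 1 (+ suc p - + 3 - + 2) ≤-refl)
                     (trans (cong δ₀ (sym (-[a+b]≡-a-b (+ suc p) (+ 3) (+ 2)))) (δ₀-≢ (suc p) 5 (>⇒≢ (s≤s 5≤p))))) ⟩
    parts[ 2 , 2 ] (+ suc p - + 3 - + 2 - + 2)
      ≡⟨ cong parts[ 2 , 2 ]_ (six (+ p)) ⟩
    v 3 ∎
    where
    six : ∀ (p : ℤ) → (+ 1 ℤ.+ p) - + 3 - + 2 - + 2 ≡ p - + 6
    six = solve-∀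

  b-two : b 2 ≡ u 2
  b-two = trans (parts-step 2 1 (+ p - + 3) ≤-refl)
                (cong (_+ u 2) (trans (parts-below 2 1 (+ p - + 3) ≤-refl) (δ₀-≢ p 3 (>⇒≢ (≤-trans (s≤s (s≤s (s≤s (s≤s z≤n)))) 5≤p)))))

  telescope : ∀ k → ∑ (3 + k) a + u (2 + k) ≡ (∑ (3 + k) b + ∑ (3 + k) σ) + v (3 + k)
  telescope zero = begin
    ((0 + a 0) + a 1) + a 2 + u 2      ≡⟨ cong (λ s → s + a 2 + u 2) a-small ⟩
    a 2 + u 2                          ≡⟨ cong (_+ u 2) a-two ⟩
    v 3 + u 2                          ≡⟨ +-comm (v 3) (u 2) ⟩
    u 2 + v 3                          ≡⟨ cong (_+ v 3) (+-identityʳ (u 2)) ⟨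
    (u 2 + 0) + v 3                    ≡⟨ cong (λ s → (s + 0) + v 3) (sym (trans (cong (_+ b 2) b-small) b-two)) ⟩
    (∑ 3 b + ∑ 3 σ) + v 3              ∎
  telescope (suc k) = begin
    (∑ X a + a X) + u X
      ≡⟨ cong (λ t → (∑ X a + t) + u X) (a-split (2 + k) (s≤s (s≤s z≤n))) ⟩
    (∑ X a + (u (2 + k) + (σ X + v (suc X)))) + u X
      ≡⟨ regroup₁ (∑ X a) (u (2 + k)) (σ X) (v (suc X)) (u X) ⟩
    (((∑ X a + u (2 + k)) + σ X) + v (suc X)) + u X
      ≡⟨ cong (λ t → ((t + σ X) + v (suc X)) + u X) (telescope k) ⟩
    ((((∑ X b + ∑ X σ) + v X) + σ X) + v (suc X)) + u X
      ≡⟨ regroup₂ (∑ X b) (∑ X σ) (v X) (u X) (σ X) (v (suc X)) ⟩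
    ((∑ X b + (v X + u X)) + (∑ X σ + σ X)) + v (suc X)
      ≡⟨ cong (λ t → ((∑ X b + t) + (∑ X σ + σ X)) + v (suc X)) (b-split (2 + k) (s≤s z≤n)) ⟨
    ((∑ X b + b X) + (∑ X σ + σ X)) + v (suc X) ∎
    where
    X = 3 + k
    regroup₁ : ∀ s a b c d → (s + (a + (b + c))) + d ≡ (((s + a) + b) + c) + d
    regroup₁ = ℕ-Solver.solve-∀
    regroup₂ : ∀ s t e f g h → ((((s + t) + e) + g) + h) + f ≡ ((s + (e + f)) + (t + g)) + h
    regroup₂ = ℕ-Solver.solve-∀

ΔqSum-step : ∀ p → 5 ≤ p → ΔqSum (suc p) ≡ ΔqSum p + specialSum (suc p)
ΔqSum-step (suc p) 5≤p = begin
  ∑ (3 + p) a                                ≡⟨ +-identityʳ (∑ (3 + p) a) ⟨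
  ∑ (3 + p) a + 0                            ≡⟨ cong (_+_ (∑ (3 + p) a)) u-top ⟨
  ∑ (3 + p) a + u (2 + p)                    ≡⟨ telescope p ⟩
  (∑ (3 + p) b + ∑ (3 + p) σ) + v (3 + p)     ≡⟨ cong₂ (λ c d → ((∑ (2 + p) b + c) + ∑ (3 + p) σ) + d) b-top v-top ⟩
  ((ΔqSum (suc p) + 0) + specialSum (2 + p)) + 0
    ≡⟨ trans (+-identityʳ _) (cong (_+ specialSum (2 + p)) (+-identityʳ (ΔqSum (suc p)))) ⟩
  ΔqSum (suc p) + specialSum (2 + p)         ∎
  where
  open Telescope (suc p) 5≤p
  u-top : u (2 + p) ≡ 0
  u-top = trans (cong parts[ 2 , 2 + p ]_ (sym (-[a+b]≡-a-b (+ suc p) (+ triangle (2 + p)) (+ (2 + p)))))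
                (box-of-negative 2 _ (2 + p) (<-≤-trans (n<1+n (suc p)) (≤-trans (n≤triangle (2 + p)) (m≤m+n (triangle (2 + p)) (2 + p)))))
  b-top : b (2 + p) ≡ 0
  b-top = box-of-negative 2 _ (2 + p) (<-≤-trans (n<1+n (suc p)) (n≤triangle (2 + p)))
  v-top : v (3 + p) ≡ 0
  v-top = box-of-negative 2 _ (2 + p) (<-≤-trans (≤-trans (n<1+n (suc p)) (n≤1+n (2 + p))) (n≤triangle (3 + p)))

q-second-difference : ∀ n → 4 ≤ n → q (2 + n) + q n ≡ 2 * q (1 + n) + specialCount (2 + n)
q-second-difference (suc n) (s≤s 3≤n) = begin
  q (3 + n) + q (1 + n)
    ≡⟨ cong₂ _+_ (q≡qSum (3 + n)) (q≡qSum (1 + n)) ⟩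
  qSum (3 + n) + qSum (1 + n)
    ≡⟨ cong (_+ qSum (1 + n)) (qSum-step (suc n)) ⟩
  (ΔqSum (3 + n) + qSum (2 + n)) + qSum (1 + n)
    ≡⟨ cong₂ (λ a b → (a + b) + qSum (1 + n)) (ΔqSum-step (2 + n) (s≤s (s≤s 3≤n))) (qSum-step n) ⟩
  ((ΔqSum (2 + n) + specialSum (3 + n)) + (ΔqSum (2 + n) + qSum (1 + n))) + qSum (1 + n)
    ≡⟨ regroup (ΔqSum (2 + n)) (specialSum (3 + n)) (qSum (1 + n)) ⟩
  2 * (ΔqSum (2 + n) + qSum (1 + n)) + specialSum (3 + n)
    ≡⟨ cong₂ (λ a b → 2 * a + b) (trans (sym (qSum-step n)) (sym (q≡qSum (2 + n)))) (sym (specialCount≡specialSum (3 + n))) ⟩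
  2 * q (2 + n) + specialCount (3 + n) ∎
  where
  regroup : ∀ d s r → ((d + s) + (d + r)) + r ≡ 2 * (d + r) + s
  regroup = ℕ-Solver.solve-∀

corollary1p5 : (n : ℕ) → 6 ≤ n → s n ≡ + specialCount n
corollary1p5 (suc (suc (suc n))) (s≤s (s≤s (s≤s 3≤n))) = +a-+b++c≡+d (q-second-difference (suc n) (s≤s 3≤n))
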